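{- Let $d\ge 3$ and $h\ge 1$ be integers, and let $G(d,h)$ be the sandpile group of the $d$-valent tree of depth $h$. Then the rank of the finite abelian group $G(d,h)$ (the minimal number of generators) is $(d-1)^h$.
   Context: Let $\mathcal{T}(d,h)$ be the ball of radius $h$ about a root vertex $0$ in the infinite $d$-regular tree: the root has $d$ children, every vertex at depth $1\le n\le h-1$ has $d-1$ children, and the vertices at depth $h$ are the leaves. Let $V$ be its vertex set, $p(i)$ the parent of a non-root vertex $i$, $C_i$ the set of children of $i$, and $\{\mathbf{x}_i: i\in V\}$ the standard basis of $\mathbb{Z}^V$. For $i\in V$ put $\delta_i = d\mathbf{x}_i - \mathbf{x}_{p(i)} - \sum_{j\in C_i}\mathbf{x}_j$, where the term $\mathbf{x}_{p(i)}$ is omitted for $i=0$ and the sum is empty for leaves. (These are the rows of the reduced Laplacian of the graph obtained by adjoining a sink joined by $d-1$ edges to each leaf.) Let $\Lambda=\sum_{i\in V}\mathbb{Z}\delta_i$. The sandpile group is $G(d,h)=\mathbb{Z}^V/\Lambda$. -}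

module Defs where

open import Data.Nat using (ℕ; zero; suc; pred; _≤_)
open import Data.Fin using (Fin)
import Data.Fin.Properties as FinP
open import Data.Integer using (ℤ; +_; _-_; _*_; _+_)
open import Data.List using (List; []; _∷_; map; concatMap; foldr)
open import Data.List.Base using (allFin)
open import Data.Maybe using (Maybe; just; nothing)
open import Data.Product using (Σ; _,_; _×_)
open import Relation.Binary.PropositionalEquality using (_≡_; refl; cong; cong₂)
open import Relation.Nullary using (Dec; yes; no)

-- Vertices.
-- Pos b k : vertices of the complete b-ary rooted tree of height k,
-- written as the path of child choices from its root.
data Pos (b : ℕ) : ℕ → Set where
  here : ∀ {k} → Pos b k
  down : ∀ {k} → Fin b → Pos b k → Pos b (suc k)

-- Vtx d h : vertex set V of T(d,h).  The root has d children; every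
-- vertex below the root lives in a (d-1)-ary tree of height h-1 hanging
-- off one of the d children of the root.
data Vtx (d : ℕ) : ℕ → Set where
  root : ∀ {h} → Vtx d h
  sub  : ∀ {h} → Fin d → Pos (pred d) h → Vtx d (suc h)

parentPos : ∀ {b k} → Pos b k → Maybe (Pos b k)
parentPos here       = nothing
parentPos (down c p) with parentPos p
... | nothing = just here
... | just q  = just (down c q)

parent : ∀ {d h} → Vtx d h → Maybe (Vtx d h)
parent root      = nothing
parent (sub c p) with parentPos p
... | nothing = just root
... | just q  = just (sub c q)

_≟P_ : ∀ {b k} → (p q : Pos b k) → Dec (p ≡ q)
here     ≟P here     = yes refl
here     ≟P down _ _ = no (λ ())
down _ _ ≟P here     = no (λ ())
down c p ≟P down c' p' with c FinP.≟ c' | p ≟P p'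
... | yes refl | yes refl = yes refl
... | no ne    | _        = no (λ { refl → ne refl })
... | yes _    | no ne    = no (λ { refl → ne refl })

_≟V_ : ∀ {d h} → (u v : Vtx d h) → Dec (u ≡ v)
root    ≟V root     = yes refl
root    ≟V sub _ _  = no (λ ())
sub _ _ ≟V root     = no (λ ())
sub c p ≟V sub c' p' with c FinP.≟ c' | p ≟P p'
... | yes refl | yes refl = yes refl
... | no ne    | _        = no (λ { refl → ne refl })
... | yes _    | no ne    = no (λ { refl → ne refl })

[_≐_] : ∀ {d h} → Vtx d h → Vtx d h → ℤ
[ u ≐ v ] with u ≟V v
... | yes _ = + 1
... | no _  = + 0

[_≐ʲ_] : ∀ {d h} → Maybe (Vtx d h) → Vtx d h → ℤ
[ nothing ≐ʲ v ] = + 0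
[ just u  ≐ʲ v ] = [ u ≐ v ]

allPos : ∀ b k → List (Pos b k)
allPos b zero    = here ∷ []
allPos b (suc k) = here ∷ concatMap (λ c → map (down c) (allPos b k)) (allFin b)

allVtx : ∀ d h → List (Vtx d h)
allVtx d zero    = root ∷ []
allVtx d (suc h) = root ∷ concatMap (λ c → map (sub c) (allPos (pred d) h)) (allFin d)

sumℤ : List ℤ → ℤ
sumℤ = foldr _+_ (+ 0)

ΣV : ∀ d h → (Vtx d h → ℤ) → ℤ
ΣV d h f = sumℤ (map f (allVtx d h))

ΣFin : ∀ s → (Fin s → ℤ) → ℤ
ΣFin s f = sumℤ (map f (allFin s))

ℤV : ℕ → ℕ → Set
ℤV d h = Vtx d h → ℤ

-- δ_i = d x_i - x_{p(i)} - Σ_{j ∈ C_i} x_j ; its v-coordinate is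
-- d[v = i] - [p(i) = v] - [p(v) = i]   (v ∈ C_i  iff  p(v) = i).
δ : ∀ d h → Vtx d h → ℤV d h
δ d h i v = (+ d) * [ v ≐ i ] - [ parent i ≐ʲ v ] - [ parent v ≐ʲ i ]

_∈Λ : ∀ {d h} → ℤV d h → Set
_∈Λ {d} {h} y = Σ (Vtx d h → ℤ) λ a → ∀ v → y v ≡ ΣV d h (λ i → a i * δ d h i v)

-- congruence modulo Λ, i.e. equality in G(d,h) = ℤ^V / Λ
_≡G_ : ∀ {d h} → ℤV d h → ℤV d h → Set
x ≡G y = (λ v → x v - y v) ∈Λ

Generates : ∀ d h s → (Fin s → ℤV d h) → Set
Generates d h s g =
  ∀ (x : ℤV d h) → Σ (Fin s → ℤ) λ c → x ≡G (λ v → ΣFin s (λ k → c k * g k v))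

HasRank : ℕ → ℕ → ℕ → Set
HasRank d h r =
  Σ (Fin r → ℤV d h) (Generates d h r) ×
  (∀ s (g : Fin s → ℤV d h) → Generates d h s g → r ≤ s)

module Submission where

-- Call a vertex marked if it is the zeroth child of its parent, measure heights from the
-- leaves, and let U be the set of unmarked vertices of even height.
--
-- U generates G(d,h): at an unmarked child b of a vertex w of odd height, δ_b expresses x_w
-- through x_b and the children of b, which have odd height again; at the parent w of a marked
-- vertex v of even height, δ_w expresses x_v through x_w, the parent of w (two levels above v)
-- and the unmarked siblings of v.  So by induction upwards on odd heights and downwards on even
-- heights every x_v lies in the span of U.
--
-- No fewer generators suffice: for u in U let f_u be the sum of (−1)^k times the indicators of
-- the vertices reached from u by k double steps, each to an arbitrary child and then to its
-- zeroth child, minus (unless u is the root) the same sum for the zeroth sibling of u.  Then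
-- f_u · δ_i = d f_u(i) and f_u(v) = [u = v] for unmarked v, so x ↦ (f_u · x mod d)_u maps
-- G(d,h) onto (ℤ/d)^U, while a group generated by s elements has at most d^s images there.
--
-- Finally |U| = (d − 1)^h, via an explicit bijection between U and digit strings in {0,…,d−2}^h.

open import Defs
open import Data.Nat as ℕ using (ℕ; zero; suc; z≤n; s≤s; pred; _≤_; _<_; _∸_; _^_)
import Data.Nat.Properties as ℕP
import Data.Nat.Divisibility as NDiv
open import Data.Nat.Induction using (<-rec)
open import Data.Bool using (Bool; true; false; not; if_then_else_)
import Data.Bool.Properties as BP
open import Data.Integer using (ℤ; +_; _+_; _*_; _-_; -_; ∣_∣; _%ℕ_; _/ℕ_)
import Data.Integer.Properties as ℤP
import Data.Integer.DivMod as ℤDM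
open import Data.Integer.Divisibility.Signed using (_∣_; divides)
import Data.Integer.Divisibility.Signed as ℤDiv
open import Data.Integer.Tactic.RingSolver using (solve-∀)
open import Data.Fin using (Fin; zero; suc; inject₁; fromℕ; toℕ; fromℕ<; finToFun; funToFin; combine)
import Data.Fin.Properties as FinP
open import Data.List using (List; []; _∷_; map; concatMap; _++_)
open import Data.List.Base using (allFin)
import Data.List.Properties as LP
open import Data.Maybe as Maybe using (Maybe; just; nothing)
import Data.Maybe.Properties as MaybeP
open import Data.Product using (_,_; _×_; proj₁; proj₂)
open import Data.Sum using (_⊎_; inj₁; inj₂)
open import Data.Unit using (⊤; tt)
open import Data.Empty using (⊥-elim)
open import Function using (_∘_)
open import Relation.Binary.Definitions using (DecidableEquality)
open import Relation.Binary.PropositionalEquality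
open import Relation.Nullary using (Dec; yes; no)
import Data.Vec.Functional as V
open V using (Vector; head; tail)

Σl : ∀ {A : Set} → (A → ℤ) → List A → ℤ
Σl f xs = sumℤ (map f xs)

Σl-cong : ∀ {A : Set} {f g : A → ℤ} (xs : List A) → (∀ x → f x ≡ g x) → Σl f xs ≡ Σl g xs
Σl-cong []       eq = refl
Σl-cong (x ∷ xs) eq = cong₂ _+_ (eq x) (Σl-cong xs eq)

Σl-zero : ∀ {A : Set} (f : A → ℤ) (xs : List A) → (∀ x → f x ≡ + 0) → Σl f xs ≡ + 0
Σl-zero f []       eq = refl
Σl-zero f (x ∷ xs) eq rewrite eq x | Σl-zero f xs eq = refl

Σl-+ : ∀ {A : Set} (f g : A → ℤ) (xs : List A) → Σl (λ x → f x + g x) xs ≡ Σl f xs + Σl g xs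
Σl-+ f g []       = refl
Σl-+ f g (x ∷ xs) rewrite Σl-+ f g xs = interchange (f x) (g x) (Σl f xs) (Σl g xs)
  where interchange : ∀ a b c d → a + b + (c + d) ≡ a + c + (b + d)
        interchange = solve-∀

Σl-*ˡ : ∀ {A : Set} (c : ℤ) (f : A → ℤ) (xs : List A) → Σl (λ x → c * f x) xs ≡ c * Σl f xs
Σl-*ˡ c f []       = sym (ℤP.*-zeroʳ c)
Σl-*ˡ c f (x ∷ xs) rewrite Σl-*ˡ c f xs = sym (ℤP.*-distribˡ-+ c (f x) (Σl f xs))

Σl-*ʳ : ∀ {A : Set} (c : ℤ) (f : A → ℤ) (xs : List A) → Σl (λ x → f x * c) xs ≡ Σl f xs * c
Σl-*ʳ c f xs = trans (Σl-cong xs (λ x → ℤP.*-comm (f x) c)) (trans (Σl-*ˡ c f xs) (ℤP.*-comm c _))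

Σl-neg : ∀ {A : Set} (f : A → ℤ) (xs : List A) → Σl (λ x → - f x) xs ≡ - Σl f xs
Σl-neg f []       = refl
Σl-neg f (x ∷ xs) rewrite Σl-neg f xs = sym (ℤP.neg-distrib-+ (f x) (Σl f xs))

Σl-- : ∀ {A : Set} (f g : A → ℤ) (xs : List A) → Σl (λ x → f x - g x) xs ≡ Σl f xs - Σl g xs
Σl-- f g xs = trans (Σl-+ f (λ x → - g x) xs) (cong (_+_ (Σl f xs)) (Σl-neg g xs))

Σl-pull : ∀ {A : Set} (f g : A → ℤ) (c : ℤ) (xs : List A) →
          Σl (λ x → f x * (c * g x)) xs ≡ c * Σl (λ x → f x * g x) xs
Σl-pull f g c xs = trans (Σl-cong xs (λ x → swap (f x) c (g x))) (Σl-*ˡ c _ xs)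
  where swap : ∀ a b c → a * (b * c) ≡ b * (a * c)
        swap = solve-∀

Σl-++ : ∀ {A : Set} (f : A → ℤ) (xs ys : List A) → Σl f (xs ++ ys) ≡ Σl f xs + Σl f ys
Σl-++ f []       ys = sym (ℤP.+-identityˡ _)
Σl-++ f (x ∷ xs) ys rewrite Σl-++ f xs ys = sym (ℤP.+-assoc (f x) (Σl f xs) (Σl f ys))

Σl-map : ∀ {A B : Set} (f : B → ℤ) (g : A → B) (xs : List A) → Σl f (map g xs) ≡ Σl (λ x → f (g x)) xs
Σl-map f g xs = cong sumℤ (sym (LP.map-∘ xs))

Σl-concatMap : ∀ {A B : Set} (f : B → ℤ) (g : A → List B) (xs : List A) →
               Σl f (concatMap g xs) ≡ Σl (λ x → Σl f (g x)) xs
Σl-concatMap f g []       = refl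
Σl-concatMap f g (x ∷ xs) = trans (Σl-++ f (g x) (concatMap g xs)) (cong (_+_ (Σl f (g x))) (Σl-concatMap f g xs))

Σl-comm : ∀ {A B : Set} (f : A → B → ℤ) (xs : List A) (ys : List B) →
          Σl (λ x → Σl (f x) ys) xs ≡ Σl (λ y → Σl (λ x → f x y) xs) ys
Σl-comm f []       ys = sym (Σl-zero _ ys (λ _ → refl))
Σl-comm f (x ∷ xs) ys = trans (cong (_+_ (Σl (f x) ys)) (Σl-comm f xs ys))
                              (sym (Σl-+ (f x) (λ y → Σl (λ x → f x y) xs) ys))

Σl-allFin-suc : ∀ n (f : Fin (suc n) → ℤ) → Σl f (allFin (suc n)) ≡ f zero + Σl (λ i → f (suc i)) (allFin n)
Σl-allFin-suc n f = cong (_+_ (f zero)) (cong sumℤ (trans (LP.map-tabulate suc f) (sym (LP.map-tabulate (λ i → i) _))))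

Σl-allFin-single : ∀ n (f : Fin n → ℤ) (i : Fin n) → (∀ j → j ≢ i → f j ≡ + 0) → Σl f (allFin n) ≡ f i
Σl-allFin-single (suc n) f zero eq = begin
  Σl f (allFin (suc n))                    ≡⟨ Σl-allFin-suc n f ⟩
  f zero + Σl (λ j → f (suc j)) (allFin n) ≡⟨ cong (_+_ (f zero)) (Σl-zero _ (allFin n) (λ j → eq (suc j) (λ ()))) ⟩
  f zero + + 0                             ≡⟨ ℤP.+-identityʳ _ ⟩
  f zero                                   ∎
  where open ≡-Reasoning
Σl-allFin-single (suc n) f (suc i) eq = begin
  Σl f (allFin (suc n))                    ≡⟨ Σl-allFin-suc n f ⟩
  f zero + Σl (λ j → f (suc j)) (allFin n) ≡⟨ cong₂ _+_ (eq zero (λ ())) rest ⟩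
  + 0 + f (suc i)                          ≡⟨ ℤP.+-identityˡ _ ⟩
  f (suc i)                                ∎
  where
  open ≡-Reasoning
  rest : Σl (λ j → f (suc j)) (allFin n) ≡ f (suc i)
  rest = Σl-allFin-single n _ i (λ j j≢i → eq (suc j) (j≢i ∘ FinP.suc-injective))

𝟙 : ∀ {P : Set} → Dec P → ℤ
𝟙 (yes _) = + 1
𝟙 (no _)  = + 0

module _ {A : Set} (_≟_ : DecidableEquality A) where

  𝟙-refl : ∀ x → 𝟙 (x ≟ x) ≡ + 1
  𝟙-refl x with x ≟ x
  ... | yes _   = refl
  ... | no x≢x = ⊥-elim (x≢x refl)

  𝟙-≢ : ∀ {x y} → x ≢ y → 𝟙 (x ≟ y) ≡ + 0
  𝟙-≢ {x} {y} x≢y with x ≟ y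
  ... | yes x≡y = ⊥-elim (x≢y x≡y)
  ... | no _    = refl

  𝟙-sym : ∀ x y → 𝟙 (x ≟ y) ≡ 𝟙 (y ≟ x)
  𝟙-sym x y with x ≟ y
  ... | yes refl = sym (𝟙-refl x)
  ... | no x≢y   = sym (𝟙-≢ (x≢y ∘ sym))

𝟙-injective : ∀ {A B : Set} (_≟ᴬ_ : DecidableEquality A) (_≟ᴮ_ : DecidableEquality B) (f : A → B) →
              (∀ {a a′} → f a ≡ f a′ → a ≡ a′) → ∀ a a′ → 𝟙 (f a ≟ᴮ f a′) ≡ 𝟙 (a ≟ᴬ a′)
𝟙-injective _≟ᴬ_ _≟ᴮ_ f f-inj a a′ with a ≟ᴬ a′
... | yes refl  = 𝟙-refl _≟ᴮ_ (f a)
... | no  a≢a′ = 𝟙-≢ _≟ᴮ_ (a≢a′ ∘ f-inj)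

𝟙-injective₂ : ∀ {A B C : Set} (_≟ᴬ_ : DecidableEquality A) (_≟ᴮ_ : DecidableEquality B)
               (_≟ᶜ_ : DecidableEquality C) (f : A → B → C) →
               (∀ {a a′ b b′} → f a b ≡ f a′ b′ → a ≡ a′ × b ≡ b′) →
               ∀ a a′ b b′ → 𝟙 (f a b ≟ᶜ f a′ b′) ≡ 𝟙 (a ≟ᴬ a′) * 𝟙 (b ≟ᴮ b′)
𝟙-injective₂ _≟ᴬ_ _≟ᴮ_ _≟ᶜ_ f f-inj a a′ b b′ with a ≟ᴬ a′ | b ≟ᴮ b′
... | yes refl | yes refl = 𝟙-refl _≟ᶜ_ (f a b)
... | yes refl | no b≢b′  = 𝟙-≢ _≟ᶜ_ (b≢b′ ∘ proj₂ ∘ f-inj)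
... | no a≢a′  | yes _    = 𝟙-≢ _≟ᶜ_ (a≢a′ ∘ proj₁ ∘ f-inj)
... | no a≢a′  | no _     = 𝟙-≢ _≟ᶜ_ (a≢a′ ∘ proj₁ ∘ f-inj)

Σl-allFin-𝟙 : ∀ n (i : Fin n) (g : Fin n → ℤ) → Σl (λ j → 𝟙 (i FinP.≟ j) * g j) (allFin n) ≡ g i
Σl-allFin-𝟙 n i g = begin
  Σl (λ j → 𝟙 (i FinP.≟ j) * g j) (allFin n) ≡⟨ Σl-allFin-single n _ i (λ j j≢i → cong (_* g j) (𝟙-≢ FinP._≟_ (j≢i ∘ sym))) ⟩
  𝟙 (i FinP.≟ i) * g i                         ≡⟨ cong (_* g i) (𝟙-refl FinP._≟_ i) ⟩
  + 1 * g i                                    ≡⟨ ℤP.*-identityˡ (g i) ⟩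
  g i                                          ∎
  where open ≡-Reasoning

module _ {d h : ℕ} where

  [≐]≡𝟙 : (u v : Vtx d h) → [ u ≐ v ] ≡ 𝟙 (u ≟V v)
  [≐]≡𝟙 u v with u ≟V v
  ... | yes _ = refl
  ... | no _  = refl

  [≐]-refl : (u : Vtx d h) → [ u ≐ u ] ≡ + 1
  [≐]-refl u = trans ([≐]≡𝟙 u u) (𝟙-refl _≟V_ u)

  [≐]-≢ : {u v : Vtx d h} → u ≢ v → [ u ≐ v ] ≡ + 0
  [≐]-≢ {u} {v} u≢v = trans ([≐]≡𝟙 u v) (𝟙-≢ _≟V_ u≢v)

  [≐]-sym : (u v : Vtx d h) → [ u ≐ v ] ≡ [ v ≐ u ]
  [≐]-sym u v = trans ([≐]≡𝟙 u v) (trans (𝟙-sym _≟V_ u v) (sym ([≐]≡𝟙 v u)))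

down-injective : ∀ {b k} {c c′ : Fin b} {p p′ : Pos b k} → Pos.down c p ≡ down c′ p′ → c ≡ c′ × p ≡ p′
down-injective refl = refl , refl

sub-injective : ∀ {d h} {c c′ : Fin d} {p p′ : Pos (pred d) h} → Vtx.sub c p ≡ sub c′ p′ → c ≡ c′ × p ≡ p′
sub-injective refl = refl , refl

ΣPos : ∀ b k → (Pos b k → ℤ) → ℤ
ΣPos b k f = Σl f (allPos b k)

ΣPos-suc : ∀ {b} k (f : Pos b (suc k) → ℤ) →
           ΣPos b (suc k) f ≡ f here + Σl (λ c → ΣPos b k (f ∘ down c)) (allFin b)
ΣPos-suc {b} k f = cong (_+_ (f here)) (trans (Σl-concatMap f _ (allFin b))
                                              (Σl-cong (allFin b) (λ c → Σl-map f (down c) (allPos b k))))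

ΣV-suc : ∀ {d} h (f : Vtx d (suc h) → ℤ) →
         ΣV d (suc h) f ≡ f root + Σl (λ c → ΣPos (pred d) h (f ∘ sub c)) (allFin d)
ΣV-suc {d} h f = cong (_+_ (f root)) (trans (Σl-concatMap f _ (allFin d))
                                            (Σl-cong (allFin d) (λ c → Σl-map f (sub c) (allPos (pred d) h))))

ΣPos-single : ∀ {b} k (f : Pos b k → ℤ) (p : Pos b k) → (∀ q → q ≢ p → f q ≡ + 0) → ΣPos b k f ≡ f p

Σl-ΣPos-single : ∀ {a b} k (F : Fin a → Pos b k → ℤ) (c : Fin a) (p : Pos b k) →
                 (∀ c′ q → (c′ , q) ≢ (c , p) → F c′ q ≡ + 0) → Σl (λ c′ → ΣPos b k (F c′)) (allFin a) ≡ F c p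
Σl-ΣPos-single {a} {b} k F c p vanish = begin
  Σl (λ c′ → ΣPos b k (F c′)) (allFin a)
    ≡⟨ Σl-allFin-single a _ c (λ c′ c′≢c → Σl-zero (F c′) (allPos b k) (λ q → vanish c′ q (c′≢c ∘ cong proj₁))) ⟩
  ΣPos b k (F c)                          ≡⟨ ΣPos-single k (F c) p (λ q q≢p → vanish c q (q≢p ∘ cong proj₂)) ⟩
  F c p                                   ∎
  where open ≡-Reasoning

Σl-ΣPos-zero : ∀ {a b} k (F : Fin a → Pos b k → ℤ) → (∀ c q → F c q ≡ + 0) →
               Σl (λ c → ΣPos b k (F c)) (allFin a) ≡ + 0
Σl-ΣPos-zero {a} {b} k F vanish = Σl-zero _ (allFin a) (λ c → Σl-zero (F c) (allPos b k) (vanish c))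

ΣPos-single zero f here vanish = ℤP.+-identityʳ _
ΣPos-single (suc k) f here vanish = begin
  ΣPos _ (suc k) f                                  ≡⟨ ΣPos-suc k f ⟩
  f here + Σl (λ c → ΣPos _ k (f ∘ down c)) (allFin _) ≡⟨ cong (_+_ (f here)) (Σl-ΣPos-zero k _ (λ c q → vanish (down c q) (λ ()))) ⟩
  f here + + 0                                      ≡⟨ ℤP.+-identityʳ _ ⟩
  f here                                            ∎
  where open ≡-Reasoning
ΣPos-single (suc k) f (down c p) vanish = begin
  ΣPos _ (suc k) f                                  ≡⟨ ΣPos-suc k f ⟩
  f here + Σl (λ c → ΣPos _ k (f ∘ down c)) (allFin _) ≡⟨ cong₂ _+_ (vanish here (λ ())) (Σl-ΣPos-single k _ c p below) ⟩
  + 0 + f (down c p)                                ≡⟨ ℤP.+-identityˡ _ ⟩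
  f (down c p)                                      ∎
  where
  open ≡-Reasoning
  below : ∀ c′ q → (c′ , q) ≢ (c , p) → f (down c′ q) ≡ + 0
  below c′ q ne = vanish (down c′ q) (λ { refl → ne refl })

ΣV-single : ∀ {d} h (f : Vtx d h → ℤ) (v : Vtx d h) → (∀ u → u ≢ v → f u ≡ + 0) → ΣV d h f ≡ f v
ΣV-single zero f root vanish = ℤP.+-identityʳ _
ΣV-single (suc h) f root vanish = begin
  ΣV _ (suc h) f                                         ≡⟨ ΣV-suc h f ⟩
  f root + Σl (λ c → ΣPos _ h (f ∘ sub c)) (allFin _) ≡⟨ cong (_+_ (f root)) (Σl-ΣPos-zero h _ (λ c q → vanish (sub c q) (λ ()))) ⟩
  f root + + 0                                           ≡⟨ ℤP.+-identityʳ _ ⟩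
  f root                                                 ∎
  where open ≡-Reasoning
ΣV-single (suc h) f (sub c p) vanish = begin
  ΣV _ (suc h) f                                         ≡⟨ ΣV-suc h f ⟩
  f root + Σl (λ c → ΣPos _ h (f ∘ sub c)) (allFin _) ≡⟨ cong₂ _+_ (vanish root (λ ())) (Σl-ΣPos-single h _ c p below) ⟩
  + 0 + f (sub c p)                                      ≡⟨ ℤP.+-identityˡ _ ⟩
  f (sub c p)                                            ∎
  where
  open ≡-Reasoning
  below : ∀ c′ q → (c′ , q) ≢ (c , p) → f (sub c′ q) ≡ + 0
  below c′ q ne = vanish (sub c′ q) (λ { refl → ne refl })

ΣV-𝟙 : ∀ {d} h (g : Vtx d h → ℤ) (v : Vtx d h) → ΣV d h (λ u → [ u ≐ v ] * g u) ≡ g v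
ΣV-𝟙 h g v = begin
  ΣV _ h (λ u → [ u ≐ v ] * g u) ≡⟨ ΣV-single h _ v (λ u u≢v → cong (_* g u) ([≐]-≢ u≢v)) ⟩
  [ v ≐ v ] * g v                ≡⟨ cong (_* g v) ([≐]-refl v) ⟩
  + 1 * g v                      ≡⟨ ℤP.*-identityˡ (g v) ⟩
  g v                            ∎
  where open ≡-Reasoning

-- The lattice Λ and spans modulo Λ

module _ {d h : ℕ} where

  infixl 6 _+ᵛ_ _-ᵛ_
  infixl 7 _·ᵛ_

  _+ᵛ_ _-ᵛ_ : ℤV d h → ℤV d h → ℤV d h
  (x +ᵛ y) v = x v + y v
  (x -ᵛ y) v = x v - y v

  _·ᵛ_ : ℤ → ℤV d h → ℤV d h
  (c ·ᵛ x) v = c * x v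

  0ᵛ : ℤV d h
  0ᵛ v = + 0

  unit : Vtx d h → ℤV d h
  unit u v = [ v ≐ u ]

  ∈Λ-resp : {x y : ℤV d h} → (∀ v → x v ≡ y v) → x ∈Λ → y ∈Λ
  ∈Λ-resp x≗y (a , x≡Σaδ) = a , λ v → trans (sym (x≗y v)) (x≡Σaδ v)

  ∈Λ-+ : {x y : ℤV d h} → x ∈Λ → y ∈Λ → (x +ᵛ y) ∈Λ
  ∈Λ-+ (a , x≡Σaδ) (b , y≡Σbδ) = (λ i → a i + b i) , λ v → begin
    _                                                           ≡⟨ cong₂ _+_ (x≡Σaδ v) (y≡Σbδ v) ⟩
    ΣV d h (λ i → a i * δ d h i v) + ΣV d h (λ i → b i * δ d h i v) ≡⟨ sym (Σl-+ _ _ (allVtx d h)) ⟩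
    ΣV d h (λ i → a i * δ d h i v + b i * δ d h i v)
      ≡⟨ sym (Σl-cong (allVtx d h) (λ i → ℤP.*-distribʳ-+ (δ d h i v) (a i) (b i))) ⟩
    ΣV d h (λ i → (a i + b i) * δ d h i v)                         ∎
    where open ≡-Reasoning

  ∈Λ-* : {x : ℤV d h} (c : ℤ) → x ∈Λ → (c ·ᵛ x) ∈Λ
  ∈Λ-* c (a , x≡Σaδ) = (λ i → c * a i) , λ v → begin
    c * _                                  ≡⟨ cong (c *_) (x≡Σaδ v) ⟩
    c * ΣV d h (λ i → a i * δ d h i v)     ≡⟨ sym (Σl-*ˡ c _ (allVtx d h)) ⟩
    ΣV d h (λ i → c * (a i * δ d h i v))   ≡⟨ sym (Σl-cong (allVtx d h) (λ i → ℤP.*-assoc c (a i) (δ d h i v))) ⟩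
    ΣV d h (λ i → c * a i * δ d h i v)     ∎
    where open ≡-Reasoning

  0∈Λ : 0ᵛ ∈Λ
  0∈Λ = (λ _ → + 0) , λ v → sym (Σl-zero _ (allVtx d h) (λ i → ℤP.*-zeroˡ (δ d h i v)))

  δ∈Λ : (i : Vtx d h) → δ d h i ∈Λ
  δ∈Λ i = (λ j → [ j ≐ i ]) , λ v → sym (ΣV-𝟙 h (λ j → δ d h j v) i)

  childrenOf : Vtx d h → ℤV d h
  childrenOf w x = [ parent x ≐ʲ w ]

  [≐ʲ]-≢ : ∀ {mu : Maybe (Vtx d h)} {v} → mu ≢ just v → [ mu ≐ʲ v ] ≡ + 0
  [≐ʲ]-≢ {nothing} _    = refl
  [≐ʲ]-≢ {just u}  u≢v = [≐]-≢ (u≢v ∘ cong just)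

  module Span {s : ℕ} (g : Fin s → ℤV d h) where

    combination : (Fin s → ℤ) → ℤV d h
    combination c v = ΣFin s (λ k → c k * g k v)

    record InSpan (x : ℤV d h) : Set where
      constructor spanned
      field
        coefficients : Fin s → ℤ
        congruent    : x ≡G combination coefficients

    InSpan-resp : {x y : ℤV d h} → (∀ v → x v ≡ y v) → InSpan x → InSpan y
    InSpan-resp x≗y (spanned c x≡c) = spanned c (∈Λ-resp (λ v → cong (_- combination c v) (x≗y v)) x≡c)

    InSpan-+ : {x y : ℤV d h} → InSpan x → InSpan y → InSpan (x +ᵛ y)
    InSpan-+ {x} {y} (spanned c x≡c) (spanned c′ y≡c′) =
      spanned (λ k → c k + c′ k) (∈Λ-resp rearrange (∈Λ-+ x≡c y≡c′))
      where
      combination-+ : ∀ v → combination (λ k → c k + c′ k) v ≡ combination c v + combination c′ v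
      combination-+ v = trans (Σl-cong (allFin s) (λ k → ℤP.*-distribʳ-+ (g k v) (c k) (c′ k))) (Σl-+ _ _ (allFin s))
      regroup : ∀ a b p q → (a - p) + (b - q) ≡ (a + b) - (p + q)
      regroup = solve-∀
      rearrange : ∀ v → (x v - combination c v) + (y v - combination c′ v) ≡ (x v + y v) - combination (λ k → c k + c′ k) v
      rearrange v = trans (regroup (x v) (y v) (combination c v) (combination c′ v)) (cong (_-_ (x v + y v)) (sym (combination-+ v)))

    InSpan-· : {x : ℤV d h} (m : ℤ) → InSpan x → InSpan (m ·ᵛ x)
    InSpan-· {x} m (spanned c x≡c) = spanned (λ k → m * c k) (∈Λ-resp rearrange (∈Λ-* m x≡c))
      where
      combination-· : ∀ v → combination (λ k → m * c k) v ≡ m * combination c v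
      combination-· v = trans (Σl-cong (allFin s) (λ k → ℤP.*-assoc m (c k) (g k v))) (Σl-*ˡ m _ (allFin s))
      rearrange : ∀ v → m * (x v - combination c v) ≡ m * x v - combination (λ k → m * c k) v
      distrib : ∀ a b c → a * (b - c) ≡ a * b - a * c
      distrib = solve-∀
      rearrange v = trans (distrib m (x v) _) (cong (_-_ (m * x v)) (sym (combination-· v)))

    InSpan-- : {x y : ℤV d h} → InSpan x → InSpan y → InSpan (x -ᵛ y)
    InSpan-- {x} {y} x∈ y∈ = InSpan-resp (λ v → cong (_+_ (x v)) (ℤP.-1*i≡-i (y v))) (InSpan-+ x∈ (InSpan-· (- + 1) y∈))

    ∈Λ⇒InSpan : {x : ℤV d h} → x ∈Λ → InSpan x
    ∈Λ⇒InSpan {x} x∈Λ = spanned (λ _ → + 0) (∈Λ-resp (λ v → sym (minus-zero v)) x∈Λ)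
      where
      minus-zero : ∀ v → x v - combination (λ _ → + 0) v ≡ x v
      minus-zero v = trans (cong (_-_ (x v)) (Σl-zero _ (allFin s) (λ k → ℤP.*-zeroˡ (g k v)))) (ℤP.+-identityʳ (x v))

    InSpan-generator : (k : Fin s) → InSpan (g k)
    InSpan-generator k = spanned (λ j → 𝟙 (k FinP.≟ j)) (∈Λ-resp (λ v → sym (cancel v)) 0∈Λ)
      where
      cancel : ∀ v → g k v - combination (λ j → 𝟙 (k FinP.≟ j)) v ≡ + 0
      cancel v = trans (cong (_-_ (g k v)) (Σl-allFin-𝟙 s k (λ j → g j v))) (ℤP.+-inverseʳ (g k v))

    InSpan-Σl : ∀ {A : Set} (x : A → ℤV d h) (as : List A) → (∀ a → InSpan (x a)) → InSpan (λ v → Σl (λ a → x a v) as)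
    InSpan-Σl x []       x∈ = ∈Λ⇒InSpan 0∈Λ
    InSpan-Σl x (a ∷ as) x∈ = InSpan-+ (x∈ a) (InSpan-Σl x as x∈)

    InSpan-fromSupport : (x : ℤV d h) → (∀ u → x u ≡ + 0 ⊎ InSpan (unit u)) → InSpan x
    InSpan-fromSupport x supported = InSpan-resp expand (InSpan-Σl (λ u → x u ·ᵛ unit u) (allVtx d h) term)
      where
      expand : ∀ v → ΣV d h (λ u → x u * unit u v) ≡ x v
      expand v = trans (Σl-cong (allVtx d h) (λ u → trans (ℤP.*-comm (x u) _) (cong (_* x u) ([≐]-sym v u)))) (ΣV-𝟙 h x v)
      term : ∀ u → InSpan (x u ·ᵛ unit u)
      term u with supported u
      ... | inj₂ unit∈ = InSpan-· (x u) unit∈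
      ... | inj₁ xu≡0  = InSpan-resp (λ v → sym (trans (cong (_* unit u v) xu≡0) (ℤP.*-zeroˡ (unit u v)))) (∈Λ⇒InSpan 0∈Λ)

    childrenOf∈span : ∀ w → (∀ x → parent x ≡ just w → InSpan (unit x)) → InSpan (childrenOf w)
    childrenOf∈span w children∈ = InSpan-fromSupport (childrenOf w) support
      where
      support : ∀ x → childrenOf w x ≡ + 0 ⊎ InSpan (unit x)
      support x with MaybeP.≡-dec _≟V_ (parent x) (just w)
      ... | yes px≡w = inj₂ (children∈ x px≡w)
      ... | no  px≢w = inj₁ ([≐ʲ]-≢ px≢w)

    childrenOf-except∈span : ∀ w v → parent v ≡ just w → (∀ x → parent x ≡ just w → x ≢ v → InSpan (unit x)) →
                             InSpan (childrenOf w -ᵛ unit v)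
    childrenOf-except∈span w v pv≡w others∈ = InSpan-fromSupport _ support
      where
      support : ∀ x → childrenOf w x - unit v x ≡ + 0 ⊎ InSpan (unit x)
      support x with x ≟V v | MaybeP.≡-dec _≟V_ (parent x) (just w)
      ... | yes refl | _        = inj₁ (cong (_- + 1) (trans (cong [_≐ʲ w ] pv≡w) ([≐]-refl w)))
      ... | no  x≢v  | yes px≡w = inj₂ (others∈ x px≡w x≢v)
      ... | no  x≢v  | no  px≢w = inj₁ (cong (_- + 0) ([≐ʲ]-≢ px≢w))

-- Heights, parents and marked vertices

heightᴾ : ∀ {b k} → Pos b k → ℕ
heightᴾ {k = k} here = k
heightᴾ (down _ p)   = heightᴾ p

height : ∀ {d h} → Vtx d h → ℕ
height {h = h} root = h
height (sub _ p)    = heightᴾ p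

heightᴾ≤ : ∀ {b k} (p : Pos b k) → heightᴾ p ≤ k
heightᴾ≤ here       = ℕP.≤-refl
heightᴾ≤ (down _ p) = ℕP.m≤n⇒m≤1+n (heightᴾ≤ p)

height≤ : ∀ {d h} (v : Vtx d h) → height v ≤ h
height≤ root      = ℕP.≤-refl
height≤ (sub _ p) = ℕP.m≤n⇒m≤1+n (heightᴾ≤ p)

isZero : ∀ {n} → Fin n → Bool
isZero zero    = true
isZero (suc _) = false

isZero-unique : ∀ {n} {x x′ : Fin n} → isZero x ≡ true → isZero x′ ≡ true → x ≡ x′
isZero-unique {x = zero} {zero} _ _ = refl

lastZeroᴾ : ∀ {b k} → Pos b k → Bool
lastZeroᴾ here                 = false
lastZeroᴾ (down c here)        = isZero c
lastZeroᴾ (down c (down c′ p)) = lastZeroᴾ (down c′ p)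

lastZero : ∀ {d h} → Vtx d h → Bool
lastZero root                = false
lastZero (sub c here)        = isZero c
lastZero (sub c (down c′ p)) = lastZeroᴾ (down c′ p)

dropLastᴾ : ∀ {b k} → Fin b → Pos b k → Pos b (suc k)
dropLastᴾ c here       = here
dropLastᴾ c (down x p) = down c (dropLastᴾ x p)

dropLast : ∀ {d h} → Fin d → Pos (pred d) h → Vtx d (suc h)
dropLast c here       = root
dropLast c (down x p) = sub c (dropLastᴾ x p)

parentPos-down : ∀ {b k} (c : Fin b) (p : Pos b k) → parentPos (down c p) ≡ just (dropLastᴾ c p)
parentPos-down c here = refl
parentPos-down c (down x p) rewrite parentPos-down x p = refl

parent-sub : ∀ {d h} (c : Fin d) (p : Pos (pred d) h) → parent (sub c p) ≡ just (dropLast c p)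
parent-sub c here       = refl
parent-sub c (down x p) rewrite parentPos-down x p = refl

heightᴾ-dropLastᴾ : ∀ {b k} (c : Fin b) (p : Pos b k) → heightᴾ (dropLastᴾ c p) ≡ suc (heightᴾ p)
heightᴾ-dropLastᴾ c here       = refl
heightᴾ-dropLastᴾ c (down x p) = heightᴾ-dropLastᴾ x p

height-dropLast : ∀ {d h} (c : Fin d) (p : Pos (pred d) h) → height (dropLast c p) ≡ suc (heightᴾ p)
height-dropLast c here       = refl
height-dropLast c (down x p) = heightᴾ-dropLastᴾ x p

height-parent : ∀ {d h} {v w : Vtx d h} → parent v ≡ just w → height w ≡ suc (height v)
height-parent {v = sub c p} eq with trans (sym (parent-sub c p)) eq
... | refl = height-dropLast c p

just-injective : ∀ {A : Set} {a b : A} → just a ≡ just b → a ≡ b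
just-injective refl = refl

private
  dropLastᴾ-lastZero-unique : ∀ {b k} (x x′ : Fin b) (y y′ : Pos b k) → dropLastᴾ x y ≡ dropLastᴾ x′ y′ →
    lastZeroᴾ (down x y) ≡ true → lastZeroᴾ (down x′ y′) ≡ true → Pos.down x y ≡ down x′ y′
  dropLastᴾ-lastZero-unique x x′ here here _ z z′ with isZero-unique z z′
  ... | refl = refl
  dropLastᴾ-lastZero-unique x x′ (down a y) (down a′ y′) eq z z′ with down-injective eq
  ... | refl , eq′ with dropLastᴾ-lastZero-unique a a′ y y′ eq′ z z′
  ... | refl = refl

  dropLast-lastZero-unique : ∀ {d h} (c c′ : Fin d) (p p′ : Pos (pred d) h) → dropLast c p ≡ dropLast c′ p′ →
    lastZero (sub c p) ≡ true → lastZero (sub c′ p′) ≡ true → Vtx.sub c p ≡ sub c′ p′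
  dropLast-lastZero-unique c c′ here here _ z z′ with isZero-unique z z′
  ... | refl = refl
  dropLast-lastZero-unique c c′ (down x y) (down x′ y′) eq z z′ with sub-injective eq
  ... | refl , eq′ with dropLastᴾ-lastZero-unique x x′ y y′ eq′ z z′
  ... | refl = refl

lastZero-unique : ∀ {d h} (u v : Vtx d h) → parent u ≡ parent v → lastZero u ≡ true → lastZero v ≡ true → u ≡ v
lastZero-unique (sub c p) (sub c′ p′) eq z z′ =
  dropLast-lastZero-unique c c′ p p′ (just-injective (trans (sym (parent-sub c p)) (trans eq (parent-sub c′ p′)))) z z′

snocᴾ : ∀ {b k} → Fin b → Pos b k → Pos b k
snocᴾ {k = zero}  x here       = here
snocᴾ {k = suc k} x here       = down x here
snocᴾ             x (down c p) = down c (snocᴾ x p)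

dropLastᴾ-snocᴾ : ∀ {b k m} (a x : Fin b) (p : Pos b k) → heightᴾ p ≡ suc m → dropLastᴾ a (snocᴾ x p) ≡ down a p
dropLastᴾ-snocᴾ a x (here {k = suc k}) _ = refl
dropLastᴾ-snocᴾ a x (down c p) hp rewrite dropLastᴾ-snocᴾ c x p hp = refl

lastZeroᴾ-snocᴾ : ∀ {b k m} (x : Fin b) (p : Pos b k) → heightᴾ p ≡ suc m → lastZeroᴾ (snocᴾ x p) ≡ isZero x
lastZeroᴾ-snocᴾ x (here {k = suc k})                 _  = refl
lastZeroᴾ-snocᴾ x (down c (here {k = suc k}))        _  = refl
lastZeroᴾ-snocᴾ x (down c (down c′ p)) hp = lastZeroᴾ-snocᴾ x (down c′ p) hp

childOne : ∀ {a h} → Vtx (3 ℕ.+ a) (suc h) → Vtx (3 ℕ.+ a) (suc h)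
childOne root      = sub (suc zero) here
childOne (sub c p) = sub c (snocᴾ (suc zero) p)

parent-childOne : ∀ {a h m} (w : Vtx (3 ℕ.+ a) (suc h)) → height w ≡ suc m → parent (childOne w) ≡ just w
parent-childOne root                     _ = refl
parent-childOne (sub c (here {k = suc k})) _ = refl
parent-childOne (sub c (down x p)) hw rewrite parentPos-down x (snocᴾ (suc zero) p) | dropLastᴾ-snocᴾ x (suc zero) p hw = refl

lastZero-childOne : ∀ {a h m} (w : Vtx (3 ℕ.+ a) (suc h)) → height w ≡ suc m → lastZero (childOne w) ≡ false
lastZero-childOne root                       _  = refl
lastZero-childOne (sub c (here {k = suc k})) _  = refl
lastZero-childOne (sub c (down x p))         hw = lastZeroᴾ-snocᴾ (suc zero) (down x p) hw

-- Unmarked vertices of even height as digit strings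

even : ℕ → Bool
even zero          = true
even (suc zero)    = false
even (suc (suc n)) = even n

even-suc : ∀ n → even (suc n) ≡ not (even n)
even-suc zero          = refl
even-suc (suc zero)    = refl
even-suc (suc (suc n)) = even-suc n

odd-suc : ∀ n → even n ≡ true → even (suc n) ≡ false
odd-suc n e = trans (even-suc n) (cong not e)

even-pred : ∀ n {b} → even (suc n) ≡ b → even n ≡ not b
even-pred n e = trans (sym (BP.not-involutive (even n))) (cong not (trans (sym (even-suc n)) e))

Unmarked : ∀ {d h} → Vtx d h → Set
Unmarked u = even (height u) ≡ true × lastZero u ≡ false

lastNonzeroᴾ : ∀ {b k} → Pos b k → Bool
lastNonzeroᴾ here                 = false
lastNonzeroᴾ (down c here)        = not (isZero c)
lastNonzeroᴾ (down c (down c′ p)) = lastNonzeroᴾ (down c′ p)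

lastNonzeroᴾ-down : ∀ {b k} (c : Fin b) (p : Pos b k) → lastNonzeroᴾ (down c p) ≡ not (lastZeroᴾ (down c p))
lastNonzeroᴾ-down c here        = refl
lastNonzeroᴾ-down c (down c′ p) = lastNonzeroᴾ-down c′ p

inject₁⁻¹ : ∀ {n} → Fin (suc n) → Maybe (Fin n)
inject₁⁻¹ {zero}  zero    = nothing
inject₁⁻¹ {suc n} zero    = just zero
inject₁⁻¹ {suc n} (suc c) = Maybe.map suc (inject₁⁻¹ c)

inject₁⁻¹-inject₁ : ∀ {n} (x : Fin n) → inject₁⁻¹ (inject₁ x) ≡ just x
inject₁⁻¹-inject₁ zero    = refl
inject₁⁻¹-inject₁ (suc x) rewrite inject₁⁻¹-inject₁ x = refl

inject₁⁻¹-fromℕ : ∀ n → inject₁⁻¹ (fromℕ n) ≡ nothing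
inject₁⁻¹-fromℕ zero    = refl
inject₁⁻¹-fromℕ (suc n) rewrite inject₁⁻¹-fromℕ n = refl

inject₁⁻¹≡just : ∀ {n} (c : Fin (suc n)) {x} → inject₁⁻¹ c ≡ just x → c ≡ inject₁ x
inject₁⁻¹≡just {suc n} zero refl = refl
inject₁⁻¹≡just {suc n} (suc c) eq with inject₁⁻¹ c in eq′
inject₁⁻¹≡just {suc n} (suc c) refl | just y = cong suc (inject₁⁻¹≡just c eq′)

inject₁⁻¹≡nothing : ∀ {n} (c : Fin (suc n)) → inject₁⁻¹ c ≡ nothing → c ≡ fromℕ n
inject₁⁻¹≡nothing {zero}  zero    refl = refl
inject₁⁻¹≡nothing {suc n} (suc c) eq with inject₁⁻¹ c in eq′
inject₁⁻¹≡nothing {suc n} (suc c) refl | nothing = cong suc (inject₁⁻¹≡nothing c eq′)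

module Encoding (a : ℕ) where

  B D : ℕ
  B = 2 ℕ.+ a
  D = suc B

  Digits : ℕ → Set
  Digits = Vector (Fin B)

  zeros : ∀ {n} → Digits n
  zeros _ = zero

  -- Normal form of a digit string: all zero, or the digits up to the last nonzero one as a
  -- path p, the number of trailing zeros being the height of p (evenTail) or one more (oddTail).
  data Form : ℕ → Set where
    allZero  : ∀ {n} → Form n
    evenTail : ∀ {n} → Pos B n → Form n
    oddTail  : ∀ {m} → Pos B m → Form (suc m)

  Valid : ∀ {n} → Form n → Set
  Valid allZero      = ⊤
  Valid (evenTail p) = lastNonzeroᴾ p ≡ true × even (heightᴾ p) ≡ true
  Valid (oddTail p)  = lastNonzeroᴾ p ≡ true × even (heightᴾ p) ≡ true

  leadingDigit : ∀ n → Fin B → Form (suc n)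
  leadingDigit n       zero    = allZero
  leadingDigit zero    (suc x) = evenTail (down (suc x) here)
  leadingDigit (suc m) (suc x) = if even (suc m) then evenTail (down (suc x) here) else oddTail (down (suc x) here)

  prepend : ∀ {n} → Fin B → Form n → Form (suc n)
  prepend {n} x allZero = leadingDigit n x
  prepend x (evenTail p) = evenTail (down x p)
  prepend x (oddTail p)  = oddTail (down x p)

  form : ∀ {n} → Digits n → Form n
  form {zero}  f = allZero
  form {suc n} f = prepend (head f) (form (tail f))

  digitsᴾ : ∀ {k} → Pos B k → Digits k
  digitsᴾ here       = zeros
  digitsᴾ (down c p) = c V.∷ digitsᴾ p

  digitsᴾ⁺ : ∀ {m} → Pos B m → Digits (suc m)
  digitsᴾ⁺ here       = zeros
  digitsᴾ⁺ (down c p) = c V.∷ digitsᴾ⁺ p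

  digits : ∀ {n} → Form n → Digits n
  digits allZero      = zeros
  digits (evenTail p) = digitsᴾ p
  digits (oddTail p)  = digitsᴾ⁺ p

  form-cong : ∀ {n} (f g : Digits n) → (∀ i → f i ≡ g i) → form f ≡ form g
  form-cong {zero}  f g f≗g = refl
  form-cong {suc n} f g f≗g = cong₂ prepend (f≗g zero) (form-cong (tail f) (tail g) (f≗g ∘ suc))

  form-zeros : ∀ n → form {n} zeros ≡ allZero
  form-zeros zero    = refl
  form-zeros (suc n) rewrite form-zeros n = refl

  digits-leadingDigit : ∀ n x i → digits (leadingDigit n x) i ≡ (x V.∷ zeros) i
  digits-leadingDigit n       zero    zero    = refl
  digits-leadingDigit n       zero    (suc i) = refl
  digits-leadingDigit zero    (suc x) i       = refl
  digits-leadingDigit (suc m) (suc x) i with even (suc m)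
  ... | true  = refl
  ... | false = refl

  digits-prepend : ∀ {n} x (r : Form n) i → digits (prepend x r) i ≡ (x V.∷ digits r) i
  digits-prepend {n} x allZero i = digits-leadingDigit n x i
  digits-prepend x (evenTail p) i = refl
  digits-prepend x (oddTail p)  i = refl

  digits-form : ∀ {n} (f : Digits n) i → digits (form f) i ≡ f i
  digits-form {suc n} f zero    = digits-prepend (head f) (form (tail f)) zero
  digits-form {suc n} f (suc i) = trans (digits-prepend (head f) (form (tail f)) (suc i)) (digits-form (tail f) i)

  valid-leadingDigit : ∀ n x → Valid (leadingDigit n x)
  valid-leadingDigit n       zero    = tt
  valid-leadingDigit zero    (suc x) = refl , refl
  valid-leadingDigit (suc m) (suc x) with even (suc m) in e
  ... | true  = refl , e
  ... | false = refl , even-pred m e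

  valid-prepend : ∀ {n} x (r : Form n) → Valid r → Valid (prepend x r)
  valid-prepend {n} x allZero           _ = valid-leadingDigit n x
  valid-prepend x (evenTail (down c p)) v = v
  valid-prepend x (oddTail (down c p))  v = v

  valid-form : ∀ {n} (f : Digits n) → Valid (form f)
  valid-form {zero}  f = tt
  valid-form {suc n} f = valid-prepend (head f) (form (tail f)) (valid-form (tail f))

  form-digits : ∀ {n} (r : Form n) → Valid r → form (digits r) ≡ r
  form-digits {n} allZero _ = form-zeros n
  form-digits {suc zero}    (evenTail (down (suc x) here)) _ = refl
  form-digits {suc (suc m)} (evenTail (down (suc x) here)) (_ , e) rewrite form-zeros (suc m) | e = refl
  form-digits (evenTail (down x (down c p))) v rewrite form-digits (evenTail (down c p)) v = refl
  form-digits {suc (suc m)} (oddTail (down (suc x) here)) (_ , e) rewrite form-zeros (suc m) | odd-suc m e = refl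
  form-digits (oddTail (down x (down c p))) v rewrite form-digits (oddTail (down c p)) v = refl

  lastChild : Fin D
  lastChild = fromℕ B

  -- An even number t of trailing zeros: the path through one of the first d − 1 children of the
  -- root, reaching height t.  An odd number: the whole string as a path below the last child
  -- of the root, reaching height t − 1.  Either way the vertex is unmarked of even height.
  formVertex : ∀ {h} → Form (suc h) → Vtx D (suc h)
  formVertex {h} allZero          = if even (suc h) then root else sub lastChild here
  formVertex (evenTail here)       = root   -- not a valid form
  formVertex (evenTail (down x p)) = sub (inject₁ x) p
  formVertex (oddTail p)           = sub lastChild p

  vertexForm : ∀ {h} → Vtx D (suc h) → Form (suc h)
  vertexForm root = allZero
  vertexForm (sub c p) with inject₁⁻¹ c
  ... | just x  = evenTail (down x p)
  ... | nothing = oddTail p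

  vertex : ∀ {h} → Digits (suc h) → Vtx D (suc h)
  vertex f = formVertex (form f)

  digitsOf : ∀ {h} → Vtx D (suc h) → Digits (suc h)
  digitsOf u = digits (vertexForm u)

  digits-vertexForm-formVertex : ∀ {h} (r : Form (suc h)) → Valid r → ∀ i → digits (vertexForm (formVertex r)) i ≡ digits r i
  digits-vertexForm-formVertex {h} allZero _ i with even (suc h)
  ... | true  = refl
  ... | false rewrite inject₁⁻¹-fromℕ B = refl
  digits-vertexForm-formVertex (evenTail (down x p)) _ i rewrite inject₁⁻¹-inject₁ x = refl
  digits-vertexForm-formVertex (oddTail p)           _ i rewrite inject₁⁻¹-fromℕ B = refl

  digitsOf-vertex : ∀ {h} (f : Digits (suc h)) i → digitsOf (vertex f) i ≡ f i
  digitsOf-vertex f i = trans (digits-vertexForm-formVertex (form f) (valid-form f) i) (digits-form f i)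

  vertex-cong : ∀ {h} (f g : Digits (suc h)) → (∀ i → f i ≡ g i) → vertex f ≡ vertex g
  vertex-cong f g f≗g = cong formVertex (form-cong f g f≗g)

  vertex-injective : ∀ {h} (f g : Digits (suc h)) → vertex f ≡ vertex g → ∀ i → f i ≡ g i
  vertex-injective f g eq i = trans (sym (digitsOf-vertex f i)) (trans (cong (λ u → digitsOf u i) eq) (digitsOf-vertex g i))

  private
    lastNonzero-true : ∀ {k} (y : Fin B) (q : Pos B k) → lastZeroᴾ (down y q) ≡ false → lastNonzeroᴾ (down y q) ≡ true
    lastNonzero-true y q z rewrite lastNonzeroᴾ-down y q | z = refl

    lastZero-false : ∀ {k} (y : Fin B) (q : Pos B k) → lastNonzeroᴾ (down y q) ≡ true → lastZeroᴾ (down y q) ≡ false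
    lastZero-false y q nz = trans (sym (BP.not-involutive _)) (cong not (trans (sym (lastNonzeroᴾ-down y q)) nz))

  vertex-digits-evenTail : ∀ {h} (x : Fin B) (p : Pos B h) → lastZero (sub (inject₁ x) p) ≡ false →
                           even (heightᴾ p) ≡ true → vertex (digits (evenTail (down x p))) ≡ sub (inject₁ x) p
  vertex-digits-evenTail {zero}  (suc x) here _ _ = refl
  vertex-digits-evenTail {suc m} (suc x) here _ e rewrite form-zeros (suc m) | e = refl
  vertex-digits-evenTail x (down y q) z e rewrite form-digits (evenTail (down y q)) (lastNonzero-true y q z , e) = refl

  vertex-digits-oddTail : ∀ {h} (p : Pos B h) → lastZero (sub lastChild p) ≡ false →
                          even (heightᴾ p) ≡ true → vertex (digits (oddTail p)) ≡ sub lastChild p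
  vertex-digits-oddTail {h} here _ e rewrite form-zeros h | odd-suc h e = refl
  vertex-digits-oddTail (down y q) z e rewrite form-digits (oddTail (down y q)) (lastNonzero-true y q z , e) = refl

  vertex-digitsOf : ∀ {h} (u : Vtx D (suc h)) → Unmarked u → vertex (digitsOf u) ≡ u
  vertex-digitsOf {h} root (e , _) rewrite form-zeros (suc h) | e = refl
  vertex-digitsOf (sub c p) (e , z) with inject₁⁻¹ c in eq
  ... | just x  rewrite inject₁⁻¹≡just c eq  = vertex-digits-evenTail x p z e
  ... | nothing rewrite inject₁⁻¹≡nothing c eq = vertex-digits-oddTail p z e

  formVertex-unmarked : ∀ {h} (r : Form (suc h)) → Valid r → Unmarked (formVertex r)
  formVertex-unmarked {h} allZero _ with even (suc h) in e
  ... | true  = e , refl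
  ... | false = even-pred h e , refl
  formVertex-unmarked (evenTail (down (suc x) here))       (_ , e)  = e , refl
  formVertex-unmarked (evenTail (down x (down y q)))       (nz , e) = e , lastZero-false y q nz
  formVertex-unmarked (oddTail (down y q))                 (nz , e) = e , lastZero-false y q nz

  vertex-unmarked : ∀ {h} (f : Digits (suc h)) → Unmarked (vertex f)
  vertex-unmarked f = formVertex-unmarked (form f) (valid-form f)


-- Upper bound

module _ {d h : ℕ} where

  unitAtParent : Vtx d h → ℤV d h
  unitAtParent w x = [ parent w ≐ʲ x ]

  unit-parent : ∀ {b w : Vtx d h} → parent b ≡ just w → ∀ x → (+ d ·ᵛ unit b -ᵛ childrenOf b -ᵛ δ d h b) x ≡ unit w x
  unit-parent {b} {w} pb≡w x rewrite pb≡w = trans (cancel (+ d * unit b x) (childrenOf b x) [ w ≐ x ]) ([≐]-sym w x)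
    where cancel : ∀ a c p → a - c - (a - p - c) ≡ p
          cancel = solve-∀

  unit-child : ∀ (w v : Vtx d h) x → (+ d ·ᵛ unit w -ᵛ unitAtParent w -ᵛ (childrenOf w -ᵛ unit v) -ᵛ δ d h w) x ≡ unit v x
  unit-child w v x = cancel (+ d * unit w x) (unitAtParent w x) (childrenOf w x) (unit v x)
    where cancel : ∀ a p c u → a - p - (c - u) - (a - p - c) ≡ u
          cancel = solve-∀

module UpperBound (a h : ℕ) where
  open Encoding a

  H r : ℕ
  H = suc h
  r = B ^ H

  basisVertex : Fin r → Vtx D H
  basisVertex j = vertex (finToFun j)

  generator : Fin r → ℤV D H
  generator j = unit (basisVertex j)

  open Span generator

  unmarked∈span : ∀ u → Unmarked u → InSpan (unit u)
  unmarked∈span u unmarked = subst (InSpan ∘ unit) encode (InSpan-generator (funToFin (digitsOf u)))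
    where
    encode : basisVertex (funToFin (digitsOf u)) ≡ u
    encode = trans (vertex-cong _ _ (FinP.finToFun-funToFin (digitsOf u))) (vertex-digitsOf u unmarked)

  oddHeight∈span : ∀ w → even (height w) ≡ false → InSpan (unit w)
  oddHeight∈span t = <-rec P step (height t) t refl
    where
    P : ℕ → Set
    P k = ∀ w → height w ≡ k → even k ≡ false → InSpan (unit w)
    step : ∀ k → (∀ {j} → j < k → P j) → P k
    step (suc m) ih w hw odd = InSpan-resp (unit-parent pb≡w) (InSpan-- (InSpan-- (InSpan-· (+ D) b∈) children∈) (∈Λ⇒InSpan (δ∈Λ b)))
      where
      b : Vtx D H
      b = childOne w
      pb≡w : parent b ≡ just w
      pb≡w = parent-childOne w hw
      hb : height b ≡ m
      hb = ℕP.suc-injective (trans (sym (height-parent {v = b} pb≡w)) hw)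
      b∈ : InSpan (unit b)
      b∈ = unmarked∈span b (trans (cong even hb) (even-pred m odd) , lastZero-childOne w hw)
      children∈ : InSpan (childrenOf b)
      children∈ = childrenOf∈span b λ x px≡b →
        let m≡1+hx = trans (sym hb) (height-parent {v = x} px≡b)
        in ih (ℕP.m≤n⇒m≤1+n (ℕP.≤-reflexive (sym m≡1+hx))) x refl
              (even-pred (height x) (trans (cong even (sym m≡1+hx)) (even-pred m odd)))

  evenHeight∈span : ∀ v → even (height v) ≡ true → InSpan (unit v)
  evenHeight∈span t = <-rec P step (H ∸ height t) t refl
    where
    P : ℕ → Set
    P k = ∀ v → H ∸ height v ≡ k → even (height v) ≡ true → InSpan (unit v)
    step : ∀ k → (∀ {j} → j < k → P j) → P k
    step k ih root      _  e = unmarked∈span root (e , refl)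
    step k ih (sub c p) dv e with lastZero (sub c p) in zv
    ... | false = unmarked∈span (sub c p) (e , zv)
    ... | true  = InSpan-resp (unit-child w v) (InSpan-- (InSpan-- (InSpan-- (InSpan-· (+ D) w∈) above∈) siblings∈) (∈Λ⇒InSpan (δ∈Λ w)))
      where
      v w : Vtx D H
      v = sub c p
      w = dropLast c p
      pv≡w : parent v ≡ just w
      pv≡w = parent-sub c p
      hw : height w ≡ suc (height v)
      hw = height-parent {v = v} pv≡w
      w∈ : InSpan (unit w)
      w∈ = oddHeight∈span w (trans (cong even hw) (odd-suc (height v) e))
      above∈ : InSpan (unitAtParent w)
      above∈ with parent w in pw
      ... | nothing = ∈Λ⇒InSpan 0∈Λ
      ... | just u  = InSpan-resp (λ x → [≐]-sym x u) (ih closer u refl (trans (cong even hu) e))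
        where
        hu : height u ≡ suc (suc (height v))
        hu = trans (height-parent {v = w} pw) (cong suc hw)
        closer : H ∸ height u < k
        closer = subst (H ∸ height u <_) dv (ℕP.∸-monoʳ-< (subst (height v <_) (sym hu) (ℕP.m≤n⇒m≤1+n ℕP.≤-refl)) (height≤ u))
      siblings∈ : InSpan (childrenOf w -ᵛ unit v)
      siblings∈ = childrenOf-except∈span w v pv≡w λ x px≡w x≢v → unmarked∈span x (sibling-even x px≡w , sibling-unmarked x px≡w x≢v)
        where
        sibling-even : ∀ x → parent x ≡ just w → even (height x) ≡ true
        sibling-even x px≡w = trans (cong even (ℕP.suc-injective (trans (sym (height-parent {v = x} px≡w)) hw))) e
        sibling-unmarked : ∀ x → parent x ≡ just w → x ≢ v → lastZero x ≡ false
        sibling-unmarked x px≡w x≢v with lastZero x in zx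
        ... | false = refl
        ... | true  = ⊥-elim (x≢v (lastZero-unique x v (trans px≡w (sym pv≡w)) zx zv))

  unit∈span : ∀ u → InSpan (unit u)
  unit∈span u with even (height u) in e
  ... | true  = evenHeight∈span u e
  ... | false = oddHeight∈span u e

  generates : Generates D H r generator
  generates x = InSpan.coefficients x∈span , InSpan.congruent x∈span
    where
    x∈span : InSpan x
    x∈span = InSpan-fromSupport x (λ u → inj₂ (unit∈span u))

-- Alternating test functions

𝟙-down : ∀ {b k} (c c′ : Fin b) (p q : Pos b k) → 𝟙 (down c p ≟P down c′ q) ≡ 𝟙 (c FinP.≟ c′) * 𝟙 (p ≟P q)
𝟙-down = 𝟙-injective₂ FinP._≟_ _≟P_ _≟P_ down down-injective

𝟙-sub : ∀ {d h} (c c′ : Fin d) (p q : Pos (pred d) h) → 𝟙 (sub c p ≟V sub c′ q) ≡ 𝟙 (c FinP.≟ c′) * 𝟙 (p ≟P q)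
𝟙-sub = 𝟙-injective₂ FinP._≟_ _≟P_ _≟V_ sub sub-injective

zeroIndicator : ∀ {b} → Fin b → ℤ
zeroIndicator zero    = + 1
zeroIndicator (suc _) = + 0

childrenᴾ : ∀ {b k} → Pos b k → List (Pos b k)
childrenᴾ {b} {zero}  here       = []
childrenᴾ {b} {suc k} here       = map (λ c → down c here) (allFin b)
childrenᴾ             (down c p) = map (down c) (childrenᴾ p)

atParentᴾ : ∀ {b k} → (Pos b k → ℤ) → Pos b k → ℤ
atParentᴾ F here       = + 0
atParentᴾ F (down x y) = F (dropLastᴾ x y)

neighbourSumᴾ : ∀ {b k} → (Pos b k → ℤ) → Pos b k → ℤ
neighbourSumᴾ F q = atParentᴾ F q + Σl F (childrenᴾ q)

parentIndicatorᴾ : ∀ {b k} → Pos b k → Pos b k → ℤ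
parentIndicatorᴾ here       q = + 0
parentIndicatorᴾ (down x y) q = 𝟙 (dropLastᴾ x y ≟P q)

-- Supported on the paths whose steps at even positions are all zero, with sign (-1)^(length/2).
alternating : ∀ {b k} → Pos b k → ℤ
alternating here                 = + 1
alternating (down c here)        = + 0
alternating (down c (down c′ p)) = zeroIndicator c′ * (- alternating p)

alternatingAt : ∀ {b k} → Pos b k → Pos b k → ℤ
alternatingAt here       q           = alternating q
alternatingAt (down c p) here        = + 0
alternatingAt (down c p) (down c′ q) = 𝟙 (c FinP.≟ c′) * alternatingAt p q

atParentᴾ-alternating : ∀ {b k} (c c′ : Fin b) (p : Pos b k) →
                        atParentᴾ alternating (down c (down c′ p)) ≡ zeroIndicator c′ * (- atParentᴾ alternating p)
atParentᴾ-alternating c c′ here       = sym (ℤP.*-zeroʳ (zeroIndicator c′))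
atParentᴾ-alternating c c′ (down x y) = refl

neighbourSumᴾ-alternating : ∀ {b} k → even k ≡ true → (q : Pos (suc b) k) → neighbourSumᴾ alternating q ≡ + 0
neighbourSumᴾ-alternating zero _ here = refl
neighbourSumᴾ-alternating {b} (suc (suc k)) _ here = begin
  + 0 + Σl alternating (map child (allFin (suc b))) ≡⟨ ℤP.+-identityˡ _ ⟩
  Σl alternating (map child (allFin (suc b)))       ≡⟨ Σl-map alternating child (allFin (suc b)) ⟩
  Σl (λ c → + 0) (allFin (suc b))                  ≡⟨ Σl-zero _ (allFin (suc b)) (λ _ → refl) ⟩
  + 0                                             ∎
  where
  open ≡-Reasoning
  child : Fin (suc b) → Pos (suc b) (suc (suc k))
  child c = down c here
neighbourSumᴾ-alternating {b} (suc (suc k)) _ (down c here) = cong (_+_ (+ 1)) (begin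
  Σl alternating (map (down c) grandchildren)            ≡⟨ Σl-map alternating (down c) grandchildren ⟩
  Σl (alternating ∘ down c) grandchildren                ≡⟨ Σl-map (alternating ∘ down c) child (allFin (suc b)) ⟩
  Σl (λ c′ → zeroIndicator c′ * - + 1) (allFin (suc b)) ≡⟨ Σl-allFin-single (suc b) _ zero only-zero ⟩
  - + 1                                                 ∎)
  where
  open ≡-Reasoning
  child : Fin (suc b) → Pos (suc b) (suc k)
  child c′ = down c′ here
  grandchildren : List (Pos (suc b) (suc k))
  grandchildren = map child (allFin (suc b))
  only-zero : ∀ c′ → c′ ≢ zero → zeroIndicator c′ * - + 1 ≡ + 0
  only-zero zero    c′≢0 = ⊥-elim (c′≢0 refl)
  only-zero (suc _) _    = refl
neighbourSumᴾ-alternating (suc (suc k)) e (down c (down c′ p)) = begin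
  atParentᴾ alternating (down c (down c′ p)) + Σl alternating (map (down c) (map (down c′) (childrenᴾ p)))
    ≡⟨ cong₂ _+_ (atParentᴾ-alternating c c′ p) children ⟩
  z * - atParentᴾ alternating p + z * - Σl alternating (childrenᴾ p)
    ≡⟨ factor z (atParentᴾ alternating p) (Σl alternating (childrenᴾ p)) ⟩
  z * - neighbourSumᴾ alternating p
    ≡⟨ cong (λ n → z * - n) (neighbourSumᴾ-alternating k e p) ⟩
  z * - + 0
    ≡⟨ ℤP.*-zeroʳ z ⟩
  + 0 ∎
  where
  open ≡-Reasoning
  z : ℤ
  z = zeroIndicator c′
  factor : ∀ a x y → a * - x + a * - y ≡ a * - (x + y)
  factor = solve-∀
  children : Σl alternating (map (down c) (map (down c′) (childrenᴾ p))) ≡ z * - Σl alternating (childrenᴾ p)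
  children = begin
    Σl alternating (map (down c) (map (down c′) (childrenᴾ p))) ≡⟨ Σl-map alternating (down c) (map (down c′) (childrenᴾ p)) ⟩
    Σl (alternating ∘ down c) (map (down c′) (childrenᴾ p))    ≡⟨ Σl-map (alternating ∘ down c) (down c′) (childrenᴾ p) ⟩
    Σl (λ y → z * - alternating y) (childrenᴾ p)               ≡⟨ Σl-*ˡ z _ (childrenᴾ p) ⟩
    z * Σl (λ y → - alternating y) (childrenᴾ p)               ≡⟨ cong (z *_) (Σl-neg alternating (childrenᴾ p)) ⟩
    z * - Σl alternating (childrenᴾ p)                         ∎

alternatingAt-here : ∀ {b k} (c : Fin b) (p : Pos b k) → alternatingAt p here ≡ 𝟙 (dropLastᴾ c p ≟P here)
alternatingAt-here c here       = refl
alternatingAt-here c (down x y) = refl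

atParentᴾ-alternatingAt : ∀ {b k} (c c′ : Fin b) (p q : Pos b k) →
                          atParentᴾ (alternatingAt (down c p)) (down c′ q) ≡ 𝟙 (c FinP.≟ c′) * atParentᴾ (alternatingAt p) q
atParentᴾ-alternatingAt c c′ p here       = sym (ℤP.*-zeroʳ (𝟙 (c FinP.≟ c′)))
atParentᴾ-alternatingAt c c′ p (down x y) = refl

parentIndicatorᴾ-down : ∀ {b k} (c c′ : Fin b) (p q : Pos b k) →
                        parentIndicatorᴾ (down c p) (down c′ q) ≡ 𝟙 (c FinP.≟ c′) * parentIndicatorᴾ p q
parentIndicatorᴾ-down c c′ here       q = sym (ℤP.*-zeroʳ (𝟙 (c FinP.≟ c′)))
parentIndicatorᴾ-down c c′ (down x y) q = 𝟙-down c c′ (dropLastᴾ x y) q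

neighbourSumᴾ-alternatingAt : ∀ {b k} (p q : Pos (suc b) k) → even (heightᴾ p) ≡ true →
                              neighbourSumᴾ (alternatingAt p) q ≡ parentIndicatorᴾ p q
neighbourSumᴾ-alternatingAt {k = k} here q e = neighbourSumᴾ-alternating k e q
neighbourSumᴾ-alternatingAt {b} (down c p) here e = begin
  + 0 + Σl (alternatingAt (down c p)) (map child (allFin (suc b))) ≡⟨ ℤP.+-identityˡ _ ⟩
  Σl (alternatingAt (down c p)) (map child (allFin (suc b)))       ≡⟨ Σl-map (alternatingAt (down c p)) child (allFin (suc b)) ⟩
  Σl (λ c′ → 𝟙 (c FinP.≟ c′) * alternatingAt p here) (allFin (suc b)) ≡⟨ Σl-allFin-𝟙 (suc b) c (λ _ → alternatingAt p here) ⟩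
  alternatingAt p here                                            ≡⟨ alternatingAt-here c p ⟩
  𝟙 (dropLastᴾ c p ≟P here)                                       ∎
  where
  open ≡-Reasoning
  child : Fin (suc b) → Pos (suc b) _
  child c′ = down c′ here
neighbourSumᴾ-alternatingAt (down c p) (down c′ q) e = begin
  atParentᴾ (alternatingAt (down c p)) (down c′ q) + Σl (alternatingAt (down c p)) (map (down c′) (childrenᴾ q))
    ≡⟨ cong₂ _+_ (atParentᴾ-alternatingAt c c′ p q) children ⟩
  i * atParentᴾ (alternatingAt p) q + i * Σl (alternatingAt p) (childrenᴾ q)
    ≡⟨ sym (ℤP.*-distribˡ-+ i _ _) ⟩
  i * neighbourSumᴾ (alternatingAt p) q
    ≡⟨ cong (i *_) (neighbourSumᴾ-alternatingAt p q e) ⟩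
  i * parentIndicatorᴾ p q
    ≡⟨ sym (parentIndicatorᴾ-down c c′ p q) ⟩
  parentIndicatorᴾ (down c p) (down c′ q) ∎
  where
  open ≡-Reasoning
  i : ℤ
  i = 𝟙 (c FinP.≟ c′)
  children : Σl (alternatingAt (down c p)) (map (down c′) (childrenᴾ q)) ≡ i * Σl (alternatingAt p) (childrenᴾ q)
  children = trans (Σl-map (alternatingAt (down c p)) (down c′) (childrenᴾ q)) (Σl-*ˡ i (alternatingAt p) (childrenᴾ q))

ΣPos-parentIndicatorᴾ : ∀ {b} k (G : Pos b k → ℤ) (p : Pos b k) →
                        ΣPos b k (λ q → G q * parentIndicatorᴾ q p) ≡ Σl G (childrenᴾ p)
ΣPos-parentIndicatorᴾ zero G here = trans (ℤP.+-identityʳ _) (ℤP.*-zeroʳ (G here))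
ΣPos-parentIndicatorᴾ {b} (suc k) G here = begin
  ΣPos b (suc k) (λ q → G q * parentIndicatorᴾ q here)
    ≡⟨ ΣPos-suc k (λ q → G q * parentIndicatorᴾ q here) ⟩
  G here * + 0 + Σl (λ c → ΣPos b k (λ y → G (down c y) * parentIndicatorᴾ (down c y) here)) (allFin b)
    ≡⟨ cong₂ _+_ (ℤP.*-zeroʳ (G here)) (Σl-cong (allFin b) (λ c → ΣPos-single k _ here (only-here c))) ⟩
  + 0 + Σl (λ c → G (child c) * + 1) (allFin b)
    ≡⟨ trans (ℤP.+-identityˡ _) (Σl-cong (allFin b) (λ c → ℤP.*-identityʳ (G (child c)))) ⟩
  Σl (G ∘ child) (allFin b)
    ≡⟨ sym (Σl-map G child (allFin b)) ⟩
  Σl G (map child (allFin b)) ∎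
  where
  open ≡-Reasoning
  child : Fin b → Pos b (suc k)
  child c = down c here
  only-here : ∀ c q → q ≢ here → G (down c q) * parentIndicatorᴾ (down c q) here ≡ + 0
  only-here c here       q≢here = ⊥-elim (q≢here refl)
  only-here c (down x z) _      = ℤP.*-zeroʳ (G (down c (down x z)))
ΣPos-parentIndicatorᴾ {b} (suc k) G (down c₀ y₀) = begin
  ΣPos b (suc k) (λ q → G q * parentIndicatorᴾ q (down c₀ y₀))
    ≡⟨ ΣPos-suc k (λ q → G q * parentIndicatorᴾ q (down c₀ y₀)) ⟩
  G here * + 0 + Σl (λ c → ΣPos b k (λ y → G (down c y) * parentIndicatorᴾ (down c y) (down c₀ y₀))) (allFin b)
    ≡⟨ cong₂ _+_ (ℤP.*-zeroʳ (G here)) (Σl-cong (allFin b) factor) ⟩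
  + 0 + Σl (λ c → 𝟙 (c₀ FinP.≟ c) * ΣPos b k (λ y → G (down c y) * parentIndicatorᴾ y y₀)) (allFin b)
    ≡⟨ trans (ℤP.+-identityˡ _) (Σl-allFin-𝟙 b c₀ _) ⟩
  ΣPos b k (λ y → G (down c₀ y) * parentIndicatorᴾ y y₀)
    ≡⟨ ΣPos-parentIndicatorᴾ k (G ∘ down c₀) y₀ ⟩
  Σl (G ∘ down c₀) (childrenᴾ y₀)
    ≡⟨ sym (Σl-map G (down c₀) (childrenᴾ y₀)) ⟩
  Σl G (map (down c₀) (childrenᴾ y₀)) ∎
  where
  open ≡-Reasoning
  factor : ∀ c → ΣPos b k (λ y → G (down c y) * parentIndicatorᴾ (down c y) (down c₀ y₀)) ≡
                 𝟙 (c₀ FinP.≟ c) * ΣPos b k (λ y → G (down c y) * parentIndicatorᴾ y y₀)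
  factor c = begin
    ΣPos b k (λ y → G (down c y) * parentIndicatorᴾ (down c y) (down c₀ y₀))
      ≡⟨ Σl-cong (allPos b k) (λ y → cong (G (down c y) *_) (trans (parentIndicatorᴾ-down c c₀ y y₀)
                                                                   (cong (_* parentIndicatorᴾ y y₀) (𝟙-sym FinP._≟_ c c₀)))) ⟩
    ΣPos b k (λ y → G (down c y) * (𝟙 (c₀ FinP.≟ c) * parentIndicatorᴾ y y₀))
      ≡⟨ Σl-pull (G ∘ down c) (λ y → parentIndicatorᴾ y y₀) (𝟙 (c₀ FinP.≟ c)) (allPos b k) ⟩
    𝟙 (c₀ FinP.≟ c) * ΣPos b k (λ y → G (down c y) * parentIndicatorᴾ y y₀) ∎

module _ {d h : ℕ} where

  ΣV-[≐ʲ] : (F : Vtx d h → ℤ) (mu : Maybe (Vtx d h)) → ΣV d h (λ x → F x * [ mu ≐ʲ x ]) ≡ Maybe.maybe F (+ 0) mu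
  ΣV-[≐ʲ] F nothing  = Σl-zero _ (allVtx d h) (λ x → ℤP.*-zeroʳ (F x))
  ΣV-[≐ʲ] F (just u) = trans (Σl-cong (allVtx d h) (λ x → trans (ℤP.*-comm (F x) _) (cong (_* F x) ([≐]-sym u x))))
                             (ΣV-𝟙 h F u)

  ΣV-δ : (F : Vtx d h → ℤ) (i : Vtx d h) →
         ΣV d h (λ x → F x * δ d h i x) ≡ + d * F i - Maybe.maybe F (+ 0) (parent i) - ΣV d h (λ x → F x * [ parent x ≐ʲ i ])
  ΣV-δ F i = begin
    ΣV d h (λ x → F x * δ d h i x)
      ≡⟨ Σl-cong (allVtx d h) (λ x → expand (F x) (+ d) [ x ≐ i ] [ parent i ≐ʲ x ] [ parent x ≐ʲ i ]) ⟩
    ΣV d h (λ x → + d * ([ x ≐ i ] * F x) - F x * [ parent i ≐ʲ x ] - F x * [ parent x ≐ʲ i ])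
      ≡⟨ trans (Σl-- _ _ (allVtx d h)) (cong (_- ΣV d h (λ x → F x * [ parent x ≐ʲ i ])) (Σl-- _ _ (allVtx d h))) ⟩
    ΣV d h (λ x → + d * ([ x ≐ i ] * F x)) - ΣV d h (λ x → F x * [ parent i ≐ʲ x ]) - ΣV d h (λ x → F x * [ parent x ≐ʲ i ])
      ≡⟨ cong (λ z → z - ΣV d h (λ x → F x * [ parent x ≐ʲ i ]))
              (cong₂ _-_ (trans (Σl-*ˡ (+ d) _ (allVtx d h)) (cong (+ d *_) (ΣV-𝟙 h F i))) (ΣV-[≐ʲ] F (parent i))) ⟩
    + d * F i - Maybe.maybe F (+ 0) (parent i) - ΣV d h (λ x → F x * [ parent x ≐ʲ i ]) ∎
    where
    open ≡-Reasoning
    expand : ∀ f dd a p c → f * (dd * a - p - c) ≡ dd * (a * f) - f * p - f * c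
    expand = solve-∀

module _ {d h : ℕ} where

  childrenSum : (Vtx d (suc h) → ℤ) → Vtx d (suc h) → ℤ
  childrenSum F root      = Σl (λ c → F (sub c here)) (allFin d)
  childrenSum F (sub c q) = Σl (F ∘ sub c) (childrenᴾ q)

  neighbourSum : (Vtx d (suc h) → ℤ) → Vtx d (suc h) → ℤ
  neighbourSum F i = Maybe.maybe F (+ 0) (parent i) + childrenSum F i

  [dropLast≐sub] : (c : Fin d) (q : Pos (pred d) h) (c₀ : Fin d) (q₀ : Pos (pred d) h) →
                   [ dropLast c q ≐ sub c₀ q₀ ] ≡ 𝟙 (c FinP.≟ c₀) * parentIndicatorᴾ q q₀
  [dropLast≐sub] c here       c₀ q₀ = sym (ℤP.*-zeroʳ (𝟙 (c FinP.≟ c₀)))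
  [dropLast≐sub] c (down x y) c₀ q₀ = trans ([≐]≡𝟙 (sub c (dropLastᴾ x y)) (sub c₀ q₀)) (𝟙-sub c c₀ (dropLastᴾ x y) q₀)

  ΣV-parent : (F : Vtx d (suc h) → ℤ) (i : Vtx d (suc h)) → ΣV d (suc h) (λ x → F x * [ parent x ≐ʲ i ]) ≡ childrenSum F i
  ΣV-parent F i = begin
    ΣV d (suc h) (λ x → F x * [ parent x ≐ʲ i ])
      ≡⟨ ΣV-suc h (λ x → F x * [ parent x ≐ʲ i ]) ⟩
    F root * + 0 + Σl (λ c → ΣPos (pred d) h (λ q → F (sub c q) * [ parent (sub c q) ≐ʲ i ])) (allFin d)
      ≡⟨ cong₂ _+_ (ℤP.*-zeroʳ (F root)) (Σl-cong (allFin d) (λ c → Σl-cong (allPos (pred d) h)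
                     (λ q → cong (λ m → F (sub c q) * [ m ≐ʲ i ]) (parent-sub c q)))) ⟩
    + 0 + Σl (λ c → ΣPos (pred d) h (λ q → F (sub c q) * [ dropLast c q ≐ i ])) (allFin d)
      ≡⟨ trans (ℤP.+-identityˡ _) (children i) ⟩
    childrenSum F i ∎
    where
    open ≡-Reasoning
    children : ∀ i → Σl (λ c → ΣPos (pred d) h (λ q → F (sub c q) * [ dropLast c q ≐ i ])) (allFin d) ≡ childrenSum F i
    children root = Σl-cong (allFin d) λ c →
      trans (ΣPos-single h _ here (only-here c)) (trans (cong (F (sub c here) *_) ([≐]-refl (root {d} {suc h}))) (ℤP.*-identityʳ _))
      where
      only-here : ∀ c q → q ≢ here → F (sub c q) * [ dropLast c q ≐ root ] ≡ + 0
      only-here c here       q≢here = ⊥-elim (q≢here refl)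
      only-here c (down x y) _      = trans (cong (F (sub c (down x y)) *_) ([≐]-≢ {u = sub c (dropLastᴾ x y)} {v = root} λ ()))
                                            (ℤP.*-zeroʳ (F (sub c (down x y))))
    children (sub c₀ q₀) = begin
      Σl (λ c → ΣPos (pred d) h (λ q → F (sub c q) * [ dropLast c q ≐ sub c₀ q₀ ])) (allFin d)
        ≡⟨ Σl-cong (allFin d) factor ⟩
      Σl (λ c → 𝟙 (c₀ FinP.≟ c) * ΣPos (pred d) h (λ q → F (sub c q) * parentIndicatorᴾ q q₀)) (allFin d)
        ≡⟨ Σl-allFin-𝟙 d c₀ _ ⟩
      ΣPos (pred d) h (λ q → F (sub c₀ q) * parentIndicatorᴾ q q₀)
        ≡⟨ ΣPos-parentIndicatorᴾ h (F ∘ sub c₀) q₀ ⟩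
      Σl (F ∘ sub c₀) (childrenᴾ q₀) ∎
      where
      factor : ∀ c → ΣPos (pred d) h (λ q → F (sub c q) * [ dropLast c q ≐ sub c₀ q₀ ]) ≡
                     𝟙 (c₀ FinP.≟ c) * ΣPos (pred d) h (λ q → F (sub c q) * parentIndicatorᴾ q q₀)
      factor c = trans (Σl-cong (allPos (pred d) h) (λ q → cong (F (sub c q) *_)
                         (trans ([dropLast≐sub] c q c₀ q₀) (cong (_* parentIndicatorᴾ q q₀) (𝟙-sym FinP._≟_ c c₀)))))
                       (Σl-pull (F ∘ sub c) (λ q → parentIndicatorᴾ q q₀) (𝟙 (c₀ FinP.≟ c)) (allPos (pred d) h))

  ΣV-δ-neighbourSum : (F : Vtx d (suc h) → ℤ) (i : Vtx d (suc h)) →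
                      ΣV d (suc h) (λ x → F x * δ d (suc h) i x) ≡ + d * F i - neighbourSum F i
  ΣV-δ-neighbourSum F i = begin
    ΣV d (suc h) (λ x → F x * δ d (suc h) i x)                             ≡⟨ ΣV-δ F i ⟩
    + d * F i - Maybe.maybe F (+ 0) (parent i) - ΣV d (suc h) (λ x → F x * [ parent x ≐ʲ i ])
                                                                          ≡⟨ cong (_-_ (+ d * F i - Maybe.maybe F (+ 0) (parent i))) (ΣV-parent F i) ⟩
    + d * F i - Maybe.maybe F (+ 0) (parent i) - childrenSum F i           ≡⟨ regroup (+ d * F i) _ _ ⟩
    + d * F i - neighbourSum F i                                          ∎
    where
    open ≡-Reasoning
    regroup : ∀ a b c → a - b - c ≡ a - (b + c)
    regroup = solve-∀

module _ {d h : ℕ} where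

  alternatingⱽ : Vtx d (suc h) → Vtx d (suc h) → ℤ
  alternatingⱽ root      root               = + 1
  alternatingⱽ root      (sub c here)       = + 0
  alternatingⱽ root      (sub c (down c′ q)) = zeroIndicator c′ * (- alternating q)
  alternatingⱽ (sub c p) root               = + 0
  alternatingⱽ (sub c p) (sub c′ q)          = 𝟙 (c FinP.≟ c′) * alternatingAt p q

  alternatingⱽ-root-sub : (c : Fin d) (x₀ : Fin (pred d)) (y : Pos (pred d) h) → alternatingⱽ root (sub c y) ≡ alternating (down x₀ y)
  alternatingⱽ-root-sub c x₀ here       = refl
  alternatingⱽ-root-sub c x₀ (down x y) = refl

  alternatingⱽ-sub-dropLast : (c₀ c : Fin d) (p q : Pos (pred d) h) →
                              alternatingⱽ (sub c₀ p) (dropLast c q) ≡ 𝟙 (c₀ FinP.≟ c) * atParentᴾ (alternatingAt p) q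
  alternatingⱽ-sub-dropLast c₀ c p here       = sym (ℤP.*-zeroʳ (𝟙 (c₀ FinP.≟ c)))
  alternatingⱽ-sub-dropLast c₀ c p (down x y) = refl

  neighbourSum-- : (F G : Vtx d (suc h) → ℤ) (i : Vtx d (suc h)) → neighbourSum (F -ᵛ G) i ≡ neighbourSum F i - neighbourSum G i
  neighbourSum-- F G i = trans (cong₂ _+_ (atParent (parent i)) (children i))
                               (regroup (Maybe.maybe F (+ 0) (parent i)) (Maybe.maybe G (+ 0) (parent i)) (childrenSum F i) (childrenSum G i))
    where
    atParent : ∀ mu → Maybe.maybe (F -ᵛ G) (+ 0) mu ≡ Maybe.maybe F (+ 0) mu - Maybe.maybe G (+ 0) mu
    atParent nothing  = refl
    atParent (just u) = refl
    children : ∀ i → childrenSum (F -ᵛ G) i ≡ childrenSum F i - childrenSum G i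
    children root      = Σl-- _ _ (allFin d)
    children (sub c q) = Σl-- _ _ (childrenᴾ q)
    regroup : ∀ a b c e → a - b + (c - e) ≡ a + c - (b + e)
    regroup = solve-∀

module _ {b h : ℕ} where
  private
    d : ℕ
    d = 2 ℕ.+ b

  neighbourSum-alternatingⱽ-sub : (c₀ : Fin d) (p : Pos (pred d) h) → even (heightᴾ p) ≡ true →
                                  ∀ i → neighbourSum (alternatingⱽ (sub c₀ p)) i ≡ [ dropLast c₀ p ≐ i ]
  neighbourSum-alternatingⱽ-sub c₀ p e root = begin
    + 0 + Σl (λ c → 𝟙 (c₀ FinP.≟ c) * alternatingAt p here) (allFin d) ≡⟨ trans (ℤP.+-identityˡ _) (Σl-allFin-𝟙 d c₀ _) ⟩
    alternatingAt p here                                               ≡⟨ here-value p ⟩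
    [ dropLast c₀ p ≐ root ]                                           ∎
    where
    open ≡-Reasoning
    here-value : (p : Pos (pred d) h) → alternatingAt p here ≡ [ dropLast c₀ p ≐ root ]
    here-value here       = sym ([≐]-refl (root {d} {suc h}))
    here-value (down x y) = sym ([≐]-≢ {u = sub c₀ (dropLastᴾ x y)} {v = root} (λ ()))
  neighbourSum-alternatingⱽ-sub c₀ p e (sub c q) = begin
    Maybe.maybe (alternatingⱽ (sub c₀ p)) (+ 0) (parent (sub c q)) + Σl (alternatingⱽ (sub c₀ p) ∘ sub c) (childrenᴾ q)
      ≡⟨ cong₂ _+_ (trans (cong (Maybe.maybe (alternatingⱽ (sub c₀ p)) (+ 0)) (parent-sub c q)) (alternatingⱽ-sub-dropLast c₀ c p q))
                   (Σl-*ˡ i (alternatingAt p) (childrenᴾ q)) ⟩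
    i * atParentᴾ (alternatingAt p) q + i * Σl (alternatingAt p) (childrenᴾ q)
      ≡⟨ sym (ℤP.*-distribˡ-+ i _ _) ⟩
    i * neighbourSumᴾ (alternatingAt p) q
      ≡⟨ cong (i *_) (neighbourSumᴾ-alternatingAt p q e) ⟩
    i * parentIndicatorᴾ p q
      ≡⟨ sym ([dropLast≐sub] c₀ p c q) ⟩
    [ dropLast c₀ p ≐ sub c q ] ∎
    where
    open ≡-Reasoning
    i : ℤ
    i = 𝟙 (c₀ FinP.≟ c)

  neighbourSum-alternatingⱽ-root : even (suc h) ≡ true → ∀ i → neighbourSum (alternatingⱽ {d} {h} root) i ≡ + 0
  neighbourSum-alternatingⱽ-root e root = trans (ℤP.+-identityˡ _) (Σl-zero _ (allFin d) (λ c → refl))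
  neighbourSum-alternatingⱽ-root e (sub c q) = begin
    Maybe.maybe (alternatingⱽ root) (+ 0) (parent (sub c q)) + Σl (alternatingⱽ root ∘ sub c) (childrenᴾ q)
      ≡⟨ cong₂ _+_ (trans (cong (Maybe.maybe (alternatingⱽ root) (+ 0)) (parent-sub c q)) (at-parent q))
                   (trans (Σl-cong (childrenᴾ q) (alternatingⱽ-root-sub c zero)) (sym (Σl-map alternating (down zero) (childrenᴾ q)))) ⟩
    neighbourSumᴾ alternating (down zero q)
      ≡⟨ neighbourSumᴾ-alternating (suc h) e (down zero q) ⟩
    + 0 ∎
    where
    open ≡-Reasoning
    at-parent : (q : Pos (suc b) h) → alternatingⱽ root (dropLast c q) ≡ alternating (dropLastᴾ zero q)
    at-parent here       = refl
    at-parent (down x y) = alternatingⱽ-root-sub c zero (dropLastᴾ x y)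

  neighbourSum-alternatingⱽ : ∀ (v w : Vtx d (suc h)) → parent v ≡ just w → even (height v) ≡ true →
                              ∀ i → neighbourSum (alternatingⱽ v) i ≡ [ w ≐ i ]
  neighbourSum-alternatingⱽ (sub c p) w pv≡w e i =
    trans (neighbourSum-alternatingⱽ-sub c p e i) (cong [_≐ i ] (just-injective (trans (sym (parent-sub c p)) pv≡w)))

  zeroLastᴾ : ∀ {k} → Fin (suc b) → Pos (suc b) k → Pos (suc b) (suc k)
  zeroLastᴾ x here       = down zero here
  zeroLastᴾ x (down y p) = down x (zeroLastᴾ y p)

  dropLastᴾ-zeroLastᴾ : ∀ {k} (x y : Fin (suc b)) (p : Pos (suc b) k) → dropLastᴾ x (zeroLastᴾ y p) ≡ dropLastᴾ x (down y p)
  dropLastᴾ-zeroLastᴾ x y here        = refl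
  dropLastᴾ-zeroLastᴾ x y (down y′ p) = cong (down x) (dropLastᴾ-zeroLastᴾ y y′ p)

  lastZeroᴾ-zeroLastᴾ : ∀ {k} (x y : Fin (suc b)) (p : Pos (suc b) k) → lastZeroᴾ (down x (zeroLastᴾ y p)) ≡ true
  lastZeroᴾ-zeroLastᴾ x y here        = refl
  lastZeroᴾ-zeroLastᴾ x y (down y′ p) = lastZeroᴾ-zeroLastᴾ y y′ p

  heightᴾ-zeroLastᴾ : ∀ {k} (y : Fin (suc b)) (p : Pos (suc b) k) → heightᴾ (zeroLastᴾ y p) ≡ heightᴾ p
  heightᴾ-zeroLastᴾ y here        = refl
  heightᴾ-zeroLastᴾ y (down y′ p) = heightᴾ-zeroLastᴾ y′ p

  zerothSibling : Fin d → Pos (pred d) h → Vtx d (suc h)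
  zerothSibling c here       = sub zero here
  zerothSibling c (down x p) = sub c (zeroLastᴾ x p)

  parent-zerothSibling : (c : Fin d) (p : Pos (pred d) h) → parent (zerothSibling c p) ≡ just (dropLast c p)
  parent-zerothSibling c here       = refl
  parent-zerothSibling c (down x here)       = refl
  parent-zerothSibling c (down x (down y p)) = trans (parent-sub c (zeroLastᴾ x (down y p))) (cong (just ∘ sub c) (dropLastᴾ-zeroLastᴾ x y p))

  lastZero-zerothSibling : (c : Fin d) (p : Pos (pred d) h) → lastZero (zerothSibling c p) ≡ true
  lastZero-zerothSibling c here       = refl
  lastZero-zerothSibling c (down x here)       = refl
  lastZero-zerothSibling c (down x (down y p)) = lastZeroᴾ-zeroLastᴾ x y p

  height-zerothSibling : (c : Fin d) (p : Pos (pred d) h) → height (zerothSibling c p) ≡ heightᴾ p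
  height-zerothSibling c here       = refl
  height-zerothSibling c (down x p) = heightᴾ-zeroLastᴾ x p

  testFunction : Vtx d (suc h) → ℤV d (suc h)
  testFunction root      = alternatingⱽ root
  testFunction (sub c p) = alternatingⱽ (sub c p) -ᵛ alternatingⱽ (zerothSibling c p)

  neighbourSum-testFunction : ∀ u → even (height u) ≡ true → ∀ i → neighbourSum (testFunction u) i ≡ + 0
  neighbourSum-testFunction root      e i = neighbourSum-alternatingⱽ-root e i
  neighbourSum-testFunction (sub c p) e i = begin
    neighbourSum (alternatingⱽ (sub c p) -ᵛ alternatingⱽ (zerothSibling c p)) i
      ≡⟨ neighbourSum-- (alternatingⱽ (sub c p)) (alternatingⱽ (zerothSibling c p)) i ⟩
    neighbourSum (alternatingⱽ (sub c p)) i - neighbourSum (alternatingⱽ (zerothSibling c p)) i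
      ≡⟨ cong₂ _-_ (neighbourSum-alternatingⱽ (sub c p) (dropLast c p) (parent-sub c p) e i)
                   (neighbourSum-alternatingⱽ (zerothSibling c p) (dropLast c p) (parent-zerothSibling c p)
                                              (trans (cong even (height-zerothSibling c p)) e) i) ⟩
    [ dropLast c p ≐ i ] - [ dropLast c p ≐ i ]
      ≡⟨ ℤP.+-inverseʳ [ dropLast c p ≐ i ] ⟩
    + 0 ∎
    where open ≡-Reasoning

  testFunction-δ : ∀ u → even (height u) ≡ true → ∀ i → ΣV d (suc h) (λ x → testFunction u x * δ d (suc h) i x) ≡ + d * testFunction u i
  testFunction-δ u e i = begin
    ΣV d (suc h) (λ x → testFunction u x * δ d (suc h) i x) ≡⟨ ΣV-δ-neighbourSum (testFunction u) i ⟩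
    + d * testFunction u i - neighbourSum (testFunction u) i ≡⟨ cong (_-_ (+ d * testFunction u i)) (neighbourSum-testFunction u e i) ⟩
    + d * testFunction u i - + 0                            ≡⟨ ℤP.+-identityʳ _ ⟩
    + d * testFunction u i                                  ∎
    where open ≡-Reasoning

  alternating-lastNonzero : ∀ {k} (q : Pos (suc b) k) → lastZeroᴾ q ≡ false → alternating q ≡ 𝟙 (here ≟P q)
  alternating-lastNonzero here                               _ = refl
  alternating-lastNonzero (down c here)                      _ = refl
  alternating-lastNonzero (down c (down (suc c′) here))      _ = refl
  alternating-lastNonzero (down c (down c′ (down x y)))      z =
    trans (cong (λ a → zeroIndicator c′ * - a) (alternating-lastNonzero (down x y) z)) (ℤP.*-zeroʳ (zeroIndicator c′))

  lastZeroᴾ-tail : ∀ {k} (c : Fin (suc b)) (q : Pos (suc b) k) → lastZeroᴾ (down c q) ≡ false → lastZeroᴾ q ≡ false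
  lastZeroᴾ-tail c here       _ = refl
  lastZeroᴾ-tail c (down x y) z = z

  alternatingAt-lastNonzero : ∀ {k} (p q : Pos (suc b) k) → lastZeroᴾ q ≡ false → alternatingAt p q ≡ 𝟙 (p ≟P q)
  alternatingAt-lastNonzero here       q           z = alternating-lastNonzero q z
  alternatingAt-lastNonzero (down c p) here        _ = refl
  alternatingAt-lastNonzero (down c p) (down c′ q) z =
    trans (cong (𝟙 (c FinP.≟ c′) *_) (alternatingAt-lastNonzero p q (lastZeroᴾ-tail c′ q z))) (sym (𝟙-down c c′ p q))

  alternatingⱽ-unmarked : (v x : Vtx d (suc h)) → lastZero x ≡ false → alternatingⱽ v x ≡ [ v ≐ x ]
  alternatingⱽ-unmarked root root _ = sym ([≐]-refl (root {d} {suc h}))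
  alternatingⱽ-unmarked root (sub c here) _ = sym ([≐]-≢ {u = root} {v = sub c (here {k = h})} (λ ()))
  alternatingⱽ-unmarked root (sub c (down c′ q)) z =
    trans (alternatingⱽ-root-sub c zero (down c′ q))
          (trans (alternating-lastNonzero (down zero (down c′ q)) z) (sym ([≐]-≢ {u = root} {v = sub c (down c′ q)} (λ ()))))
  alternatingⱽ-unmarked (sub c p) root _ = sym ([≐]-≢ {u = sub c p} {v = root} (λ ()))
  alternatingⱽ-unmarked (sub c p) (sub c′ q) z =
    trans (cong (𝟙 (c FinP.≟ c′) *_) (alternatingAt-lastNonzero p q (lastZeroᴾ-sub q z)))
          (sym (trans ([≐]≡𝟙 (sub c p) (sub c′ q)) (𝟙-sub c c′ p q)))
    where
    lastZeroᴾ-sub : (q : Pos (suc b) h) → lastZero (sub c′ q) ≡ false → lastZeroᴾ q ≡ false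
    lastZeroᴾ-sub here       _ = refl
    lastZeroᴾ-sub (down x y) z = z

  testFunction-unmarked : (u x : Vtx d (suc h)) → lastZero x ≡ false → testFunction u x ≡ [ u ≐ x ]
  testFunction-unmarked root      x z = alternatingⱽ-unmarked root x z
  testFunction-unmarked (sub c p) x z = begin
    alternatingⱽ (sub c p) x - alternatingⱽ (zerothSibling c p) x
      ≡⟨ cong₂ _-_ (alternatingⱽ-unmarked (sub c p) x z) (alternatingⱽ-unmarked (zerothSibling c p) x z) ⟩
    [ sub c p ≐ x ] - [ zerothSibling c p ≐ x ]
      ≡⟨ cong (_-_ [ sub c p ≐ x ]) ([≐]-≢ sibling≢x) ⟩
    [ sub c p ≐ x ] - + 0
      ≡⟨ ℤP.+-identityʳ _ ⟩
    [ sub c p ≐ x ] ∎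
    where
    open ≡-Reasoning
    sibling≢x : zerothSibling c p ≢ x
    sibling≢x refl = BP.not-¬ (lastZero-zerothSibling c p) z

-- Lower bound

module _ {d h : ℕ} where

  ⟨_,_⟩ : ℤV d h → ℤV d h → ℤ
  ⟨ F , y ⟩ = ΣV d h (λ x → F x * y x)

  ⟨⟩-- : (F y z : ℤV d h) → ⟨ F , y -ᵛ z ⟩ ≡ ⟨ F , y ⟩ - ⟨ F , z ⟩
  ⟨⟩-- F y z = trans (Σl-cong (allVtx d h) (λ x → distrib (F x) (y x) (z x))) (Σl-- _ _ (allVtx d h))
    where distrib : ∀ f a b → f * (a - b) ≡ f * a - f * b
          distrib = solve-∀

  ⟨⟩-unit : (F : ℤV d h) (w : Vtx d h) → ⟨ F , unit w ⟩ ≡ F w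
  ⟨⟩-unit F w = trans (Σl-cong (allVtx d h) (λ x → ℤP.*-comm (F x) [ x ≐ w ])) (ΣV-𝟙 h F w)

  ⟨⟩-combination : ∀ {s} (F : ℤV d h) (g : Fin s → ℤV d h) (c : Fin s → ℤ) →
                   ⟨ F , Span.combination g c ⟩ ≡ ΣFin s (λ k → c k * ⟨ F , g k ⟩)
  ⟨⟩-combination {s} F g c = begin
    ΣV d h (λ x → F x * ΣFin s (λ k → c k * g k x))        ≡⟨ Σl-cong (allVtx d h) (λ x → sym (Σl-*ˡ (F x) _ (allFin s))) ⟩
    ΣV d h (λ x → ΣFin s (λ k → F x * (c k * g k x)))      ≡⟨ Σl-comm (λ x k → F x * (c k * g k x)) (allVtx d h) (allFin s) ⟩
    ΣFin s (λ k → ΣV d h (λ x → F x * (c k * g k x)))      ≡⟨ Σl-cong (allFin s) (λ k → Σl-pull F (g k) (c k) (allVtx d h)) ⟩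
    ΣFin s (λ k → c k * ⟨ F , g k ⟩)                        ∎
    where open ≡-Reasoning

  ⟨⟩-Λ : (F : ℤV d h) → (∀ i → ⟨ F , δ d h i ⟩ ≡ + d * F i) → ∀ {y} → y ∈Λ → + d ∣ ⟨ F , y ⟩
  ⟨⟩-Λ F eigen {y} (a , y≡Σaδ) = divides (ΣV d h (λ i → a i * F i)) (begin
    ΣV d h (λ x → F x * y x)                                 ≡⟨ Σl-cong (allVtx d h) (λ x → cong (F x *_) (y≡Σaδ x)) ⟩
    ΣV d h (λ x → F x * ΣV d h (λ i → a i * δ d h i x))      ≡⟨ Σl-cong (allVtx d h) (λ x → sym (Σl-*ˡ (F x) _ (allVtx d h))) ⟩
    ΣV d h (λ x → ΣV d h (λ i → F x * (a i * δ d h i x)))    ≡⟨ Σl-comm (λ x i → F x * (a i * δ d h i x)) (allVtx d h) (allVtx d h) ⟩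
    ΣV d h (λ i → ΣV d h (λ x → F x * (a i * δ d h i x)))    ≡⟨ Σl-cong (allVtx d h) (λ i → Σl-pull F (δ d h i) (a i) (allVtx d h)) ⟩
    ΣV d h (λ i → a i * ⟨ F , δ d h i ⟩)
      ≡⟨ Σl-cong (allVtx d h) (λ i → trans (cong (a i *_) (eigen i)) (swap (a i) (+ d) (F i))) ⟩
    ΣV d h (λ i → a i * F i * + d)                           ≡⟨ Σl-*ʳ (+ d) (λ i → a i * F i) (allVtx d h) ⟩
    ΣV d h (λ i → a i * F i) * + d                           ∎)
    where
    open ≡-Reasoning
    swap : ∀ a b c → a * (b * c) ≡ a * c * b
    swap = solve-∀

*-minus-%ℕ : ∀ c w D .{{_ : ℕ.NonZero D}} → c * w - + (c %ℕ D) * w ≡ (c /ℕ D) * w * + D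
*-minus-%ℕ c w D = begin
  c * w - + (c %ℕ D) * w                               ≡⟨ cong (λ x → x * w - + (c %ℕ D) * w) (ℤDM.a≡a%ℕn+[a/ℕn]*n c D) ⟩
  (+ (c %ℕ D) + (c /ℕ D) * + D) * w - + (c %ℕ D) * w ≡⟨ cancel (+ (c %ℕ D)) (c /ℕ D) (+ D) w ⟩
  (c /ℕ D) * w * + D                                   ∎
  where
  open ≡-Reasoning
  cancel : ∀ m q n w → (m + q * n) * w - m * w ≡ q * w * n
  cancel = solve-∀

residue-unique : ∀ {D m n} → m < D → n < D → + D ∣ + m - + n → m ≡ n
residue-unique {D} {m} {n} m<D n<D D∣m-n =
  ℤP.+-injective (ℤP.i-j≡0⇒i≡j (+ m) (+ n) (ℤP.∣i∣≡0⇒i≡0 (small ∣ + m - + n ∣ bound (ℤDiv.∣⇒∣ᵤ D∣m-n))))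
  where
  bound : ∣ + m - + n ∣ < D
  bound = ℕP.≤-<-trans (ℕP.≤-reflexive (cong ∣_∣ (ℤP.[+m]-[+n]≡m⊖n m n)))
                       (ℕP.≤-<-trans (ℤP.∣m⊝n∣≤m⊔n m n) (ℕP.⊔-lub m<D n<D))
  small : ∀ k → k < D → D NDiv.∣ k → k ≡ 0
  small zero    _   _   = refl
  small (suc k) k<D D∣k = ⊥-elim (ℕP.<⇒≱ k<D (NDiv.∣⇒≤ D∣k))

funToFin-cong : ∀ {m n} (f g : Fin m → Fin n) → (∀ i → f i ≡ g i) → funToFin f ≡ funToFin g
funToFin-cong {zero}  f g f≗g = refl
funToFin-cong {suc m} f g f≗g = cong₂ combine (f≗g zero) (funToFin-cong (f ∘ suc) (g ∘ suc) (f≗g ∘ suc))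

strings-injection⇒≤ : ∀ {D r s} → 1 < D → (σ : (Fin r → Fin D) → (Fin s → Fin D)) →
                      (∀ t t′ → (∀ k → σ t k ≡ σ t′ k) → ∀ j → t j ≡ t′ j) → r ≤ s
strings-injection⇒≤ {D} {r} {s} 1<D σ σ-injective with r ℕP.≤? s
... | yes r≤s = r≤s
... | no  r≰s = ⊥-elim (ℕP.<⇒≱ (ℕP.^-monoʳ-< D 1<D (ℕP.≰⇒> r≰s)) (FinP.injective⇒≤ σ′-injective))
  where
  σ′ : Fin (D ^ r) → Fin (D ^ s)
  σ′ = funToFin ∘ σ ∘ finToFun {D} {r}
  σ′-injective : ∀ {k k′} → σ′ k ≡ σ′ k′ → k ≡ k′
  σ′-injective {k} {k′} eq = begin
    k                               ≡⟨ FinP.funToFin-finToFin {r} {D} k ⟨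
    funToFin (finToFun {D} {r} k)   ≡⟨ funToFin-cong _ _ (σ-injective (finToFun k) (finToFun k′) σ-agree) ⟩
    funToFin (finToFun {D} {r} k′)  ≡⟨ FinP.funToFin-finToFin {r} {D} k′ ⟩
    k′                              ∎
    where
    open ≡-Reasoning
    σ-agree : ∀ i → σ (finToFun k) i ≡ σ (finToFun k′) i
    σ-agree i = trans (sym (FinP.finToFun-funToFin (σ (finToFun k)) i))
                      (trans (cong (λ z → finToFun z i) eq) (FinP.finToFun-funToFin (σ (finToFun k′)) i))

module LowerBound (a h : ℕ) where
  open Encoding a
  open UpperBound a h using (H; r; basisVertex; generator)

  basisVertex-injective : ∀ {j j′} → basisVertex j ≡ basisVertex j′ → j ≡ j′
  basisVertex-injective {j} {j′} eq = begin
    j                              ≡⟨ FinP.funToFin-finToFin {H} {B} j ⟨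
    funToFin (finToFun {B} {H} j)  ≡⟨ funToFin-cong (finToFun j) (finToFun j′) (vertex-injective (finToFun j) (finToFun j′) eq) ⟩
    funToFin (finToFun {B} {H} j′) ≡⟨ FinP.funToFin-finToFin {H} {B} j′ ⟩
    j′                             ∎
    where open ≡-Reasoning

  dual : Fin r → ℤV D H
  dual j = testFunction (basisVertex j)

  dual-δ : ∀ j i → ⟨ dual j , δ D H i ⟩ ≡ + D * dual j i
  dual-δ j i = testFunction-δ (basisVertex j) (proj₁ (vertex-unmarked (finToFun {B} {H} j))) i

  dual-generator : ∀ j j′ → ⟨ dual j , generator j′ ⟩ ≡ 𝟙 (j FinP.≟ j′)
  dual-generator j j′ = begin
    ⟨ dual j , unit (basisVertex j′) ⟩  ≡⟨ ⟨⟩-unit (dual j) (basisVertex j′) ⟩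
    dual j (basisVertex j′)            ≡⟨ testFunction-unmarked (basisVertex j) (basisVertex j′) (proj₂ (vertex-unmarked (finToFun {B} {H} j′))) ⟩
    [ basisVertex j ≐ basisVertex j′ ] ≡⟨ [≐]≡𝟙 (basisVertex j) (basisVertex j′) ⟩
    𝟙 (basisVertex j ≟V basisVertex j′) ≡⟨ 𝟙-injective FinP._≟_ _≟V_ basisVertex basisVertex-injective j j′ ⟩
    𝟙 (j FinP.≟ j′)                    ∎
    where open ≡-Reasoning

  digitVector : (Fin r → Fin D) → ℤV D H
  digitVector t = Span.combination generator (λ j → + toℕ (t j))

  dual-digitVector : ∀ t j → ⟨ dual j , digitVector t ⟩ ≡ + toℕ (t j)
  dual-digitVector t j = begin
    ⟨ dual j , digitVector t ⟩                              ≡⟨ ⟨⟩-combination (dual j) generator (λ j′ → + toℕ (t j′)) ⟩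
    ΣFin r (λ j′ → + toℕ (t j′) * ⟨ dual j , generator j′ ⟩)
      ≡⟨ Σl-cong (allFin r) (λ j′ → trans (cong (+ toℕ (t j′) *_) (dual-generator j j′)) (ℤP.*-comm (+ toℕ (t j′)) _)) ⟩
    ΣFin r (λ j′ → 𝟙 (j FinP.≟ j′) * + toℕ (t j′))           ≡⟨ Σl-allFin-𝟙 r j (λ j′ → + toℕ (t j′)) ⟩
    + toℕ (t j)                                             ∎
    where open ≡-Reasoning

  module _ {s : ℕ} (g : Fin s → ℤV D H) (gen : Generates D H s g) where

    coefficients : (Fin r → Fin D) → Fin s → ℤ
    coefficients t = proj₁ (gen (digitVector t))

    residues : (Fin r → Fin D) → Fin s → Fin D
    residues t k = fromℕ< (ℤDM.n%ℕd<d (coefficients t k) D)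

    residueSum : (Fin r → Fin D) → Fin r → ℤ
    residueSum t j = ΣFin s (λ k → + toℕ (residues t k) * ⟨ dual j , g k ⟩)

    digit≡residueSum : ∀ t j → + D ∣ + toℕ (t j) - residueSum t j
    digit≡residueSum t j = subst (+ D ∣_) (regroup (+ toℕ (t j)) (ΣFin s (λ k → c k * W k)) (residueSum t j))
                                 (ℤDiv.∣m∣n⇒∣m+n modΛ (divides quotients reduce))
      where
      c : Fin s → ℤ
      c = coefficients t
      W : Fin s → ℤ
      W k = ⟨ dual j , g k ⟩
      regroup : ∀ x y z → (x - y) + (y - z) ≡ x - z
      regroup = solve-∀
      modΛ : + D ∣ + toℕ (t j) - ΣFin s (λ k → c k * W k)
      modΛ = subst (+ D ∣_) (trans (⟨⟩-- (dual j) (digitVector t) _)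
                                   (cong₂ _-_ (dual-digitVector t j) (⟨⟩-combination (dual j) g c)))
                   (⟨⟩-Λ (dual j) (dual-δ j) (proj₂ (gen (digitVector t))))
      quotients : ℤ
      quotients = ΣFin s (λ k → (c k /ℕ D) * W k)
      split : ∀ k → c k * W k - + toℕ (residues t k) * W k ≡ (c k /ℕ D) * W k * + D
      split k = trans (cong (λ x → c k * W k - + x * W k) (FinP.toℕ-fromℕ< (ℤDM.n%ℕd<d (c k) D))) (*-minus-%ℕ (c k) (W k) D)
      reduce : ΣFin s (λ k → c k * W k) - residueSum t j ≡ quotients * + D
      reduce = begin
        ΣFin s (λ k → c k * W k) - residueSum t j                      ≡⟨ Σl-- _ _ (allFin s) ⟨
        ΣFin s (λ k → c k * W k - + toℕ (residues t k) * W k)          ≡⟨ Σl-cong (allFin s) split ⟩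
        ΣFin s (λ k → (c k /ℕ D) * W k * + D)                          ≡⟨ Σl-*ʳ (+ D) _ (allFin s) ⟩
        quotients * + D                                                ∎
        where open ≡-Reasoning

    residues-injective : ∀ t t′ → (∀ k → residues t k ≡ residues t′ k) → ∀ j → t j ≡ t′ j
    residues-injective t t′ same j = FinP.toℕ-injective (residue-unique (FinP.toℕ<n (t j)) (FinP.toℕ<n (t′ j)) D∣t-t′)
      where
      sameSum : residueSum t j ≡ residueSum t′ j
      sameSum = Σl-cong (allFin s) (λ k → cong (λ x → + toℕ x * ⟨ dual j , g k ⟩) (same k))
      cancel : ∀ x y z → (x - z) - (y - z) ≡ x - y
      cancel = solve-∀
      D∣t-t′ : + D ∣ + toℕ (t j) - + toℕ (t′ j)
      D∣t-t′ = subst (+ D ∣_) (cancel (+ toℕ (t j)) (+ toℕ (t′ j)) (residueSum t j))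
                     (ℤDiv.∣m∣n⇒∣m-n (digit≡residueSum t j)
                                     (subst (λ x → + D ∣ + toℕ (t′ j) - x) (sym sameSum) (digit≡residueSum t′ j)))

  rank-≤ : ∀ s (g : Fin s → ℤV D H) → Generates D H s g → r ≤ s
  rank-≤ s g gen = strings-injection⇒≤ (s≤s (s≤s z≤n)) (residues g gen) (residues-injective g gen)

theorem2p1 : ∀ (d h : ℕ) → 3 ≤ d → 1 ≤ h → HasRank d h ((d ∸ 1) ^ h)
theorem2p1 (suc (suc (suc a))) (suc h) _              _ = (UpperBound.generator a h , UpperBound.generates a h) , LowerBound.rank-≤ a h
theorem2p1 (suc (suc zero))    _       (s≤s (s≤s ())) _
theorem2p1 (suc zero)          _       (s≤s ())       _
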